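{- Let $\ell\ge2$ and let $\lambda$ be an $\ell$-core. Then $w(\lambda)$ is a reduced expression for the minimal length element of the coset $t_{\pi^{ -1}(\lambda)}S_\ell$ of $\widetilde{S_\ell}/S_\ell$, and its Coxeter length is \[ l(w(\lambda))=\sum_{i}\lambda_{R(i)}, \] the sum over those residues $i\in\{0,\ldots,\ell-1\}$ for which some row of $\lambda$ has rightmost box of residue $i$, where $R(i)$ is the longest row of $\lambda$ whose rightmost box has residue $i$.
   Context: Partitions are in English notation; box $(x,y)$ (row $x$, column $y$) has residue the least nonnegative integer $\equiv y-x \pmod\ell$; hook length of a box is the number of boxes weakly right of it in its row or weakly below it in its column; an $\ell$-core has no hook length divisible by $\ell$. Let $V=\{\mathbf{a}\in\mathbf{R}^\ell:\sum a_j=0\}$, $\Lambda_R=V\cap\mathbf{Z}^\ell$. The affine symmetric group $\widetilde{S_\ell}$ is the Coxeter group with generators $s_0,\ldots,s_{\ell-1}$ acting on $V$: for $1\le i\le\ell-1$, $s_i$ interchanges coordinates $a_i,a_{i+1}$; $s_0(a_1,\ldots,a_\ell)=(a_\ell+1,a_2,\ldots,a_{\ell-1},a_1-1)$. $S_\ell=\langle s_1,\ldots,s_{\ell-1}\rangle$ and $t_{\mathbf{a}}$ denotes translation by $\mathbf{a}\in\Lambda_R$, an element of $\widetilde{S_\ell}$. For $\mathbf{a}\in\Lambda_R$, let $X(\mathbf{a})=\{r\ell+(j-1):1\le j\le\ell,\ r\le a_j\}$ and $\pi(\mathbf{a})$ the partition whose parts are the nonzero values of $|\{y\notin X(\mathbf{a}):y<x\}|$,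 $x\in X(\mathbf{a})$; $\pi$ is a bijection from $\Lambda_R$ to $\ell$-cores. For an $\ell$-core $\lambda$ set $s_i(\lambda)=\pi(s_i\pi^{ -1}(\lambda))$. The word $w(\lambda)$ in the generators is defined recursively: $w(\emptyset)$ is the empty word; for $\lambda\ne\emptyset$, let $i$ be the residue of the rightmost box of the last nonzero row of $\lambda$, and set $w(\lambda)=s_i\,w(s_i(\lambda))$. -}

module Defs where

open import Data.Nat as ℕ using (ℕ; zero; suc; NonZero; _≤_)
open import Data.Integer as ℤ using (ℤ; +_; _/ℕ_; _%ℕ_; ∣_∣)
open import Data.Integer.DivMod using (n%ℕd<d)
open import Data.Fin as Fin using (Fin; toℕ; fromℕ; inject₁; fromℕ<)
open import Data.Bool using (Bool; true; false; if_then_else_; not)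
open import Data.List using (List; []; _∷_; length; map; filterᵇ; upTo; reverse; foldr)
open import Data.Nat.ListAction using (sum)
open import Data.List.Relation.Unary.All using (All)
open import Data.Product using (Σ; ∃; _×_; _,_)
open import Relation.Nullary using (¬_; does)
open import Relation.Binary.PropositionalEquality using (_≡_; _≢_)

-- Vectors in Z^ℓ (coordinates a_1..a_ℓ are indices 0..ℓ-1 of Fin ℓ)

Vecℤ : ℕ → Set
Vecℤ ℓ = Fin ℓ → ℤ

sumℤ : ∀ {ℓ} → Vecℤ ℓ → ℤ
sumℤ {zero}  a = + 0
sumℤ {suc n} a = a Fin.zero ℤ.+ sumℤ {n} (λ k → a (Fin.suc k))

InΛR : ∀ {ℓ} → Vecℤ ℓ → Set
InΛR a = sumℤ a ≡ + 0

-- Generator s_i is indexed by i : Fin ℓ.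
--   s_0 (a_1,…,a_ℓ) = (a_ℓ + 1, a_2, …, a_{ℓ-1}, a_1 - 1)
--   s_i (1 ≤ i ≤ ℓ-1) interchanges a_i and a_{i+1}
--     (0-based positions i-1 = inject₁ j and i = suc j when i = suc j).

gen : ∀ {ℓ} → Fin ℓ → Vecℤ ℓ → Vecℤ ℓ
gen {suc m} Fin.zero a k =
  if does (k Fin.≟ Fin.zero) then a (fromℕ m) ℤ.+ + 1
  else if does (k Fin.≟ fromℕ m) then a Fin.zero ℤ.- + 1
  else a k
gen {suc m} (Fin.suc j) a k =
  if does (k Fin.≟ inject₁ j) then a (Fin.suc j)
  else if does (k Fin.≟ Fin.suc j) then a (inject₁ j)
  else a k

Word : ℕ → Set
Word ℓ = List (Fin ℓ)

act : ∀ {ℓ} → Word ℓ → Vecℤ ℓ → Vecℤ ℓ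
act []      a = a
act (i ∷ w) a = gen i (act w a)

-- Two words represent the same element of the affine symmetric group iff
-- they act identically (the action on V is faithful, and an affine map of
-- V is determined by its values on the affinely spanning set Λ_R).
SameElt : ∀ {ℓ} → Word ℓ → Word ℓ → Set
SameElt {ℓ} u v = ∀ (x : Vecℤ ℓ) → InΛR x → ∀ k → act u x k ≡ act v x k

-- Words in s_1,…,s_{ℓ-1}: they represent exactly the elements of S_ℓ.
IsFiniteWord : ∀ {ℓ} → Word ℓ → Set
IsFiniteWord w = All (λ i → toℕ i ≢ 0) w

-- The element represented by u lies in the coset t_a S_ℓ, i.e.
-- u = t_a σ for some σ ∈ S_ℓ, where t_a is translation by a.
InCoset : ∀ {ℓ} → Vecℤ ℓ → Word ℓ → Set
InCoset {ℓ} a u = Σ (Word ℓ) λ σ → IsFiniteWord σ ×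
  (∀ (x : Vecℤ ℓ) → InΛR x → ∀ k → act u x k ≡ act σ x k ℤ.+ a k)

IsReduced : ∀ {ℓ} → Word ℓ → Set
IsReduced {ℓ} u = ∀ (v : Word ℓ) → SameElt v u → length u ≤ length v

CoxLen : ∀ {ℓ} → Word ℓ → ℕ → Set
CoxLen {ℓ} u n =
  (Σ (Word ℓ) λ v → SameElt v u × length v ≡ n) ×
  (∀ (v : Word ℓ) → SameElt v u → n ≤ length v)

-- Partitions are lists of positive parts in weakly decreasing order.

Partition : Set
Partition = List ℕ

-- The map π : Λ_R → ℓ-cores.
-- X(a) = { rℓ + (j-1) : 1 ≤ j ≤ ℓ, r ≤ a_j }; an integer x lies in X(a)
-- iff  (x div ℓ) ≤ a_{(x mod ℓ)+1}  (floor division, 0 ≤ x mod ℓ < ℓ).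
module _ {ℓ : ℕ} .{{_ : NonZero ℓ}} where

  inX : Vecℤ ℓ → ℤ → Bool
  inX a x = does ((x /ℕ ℓ) ℤ.≤? a (fromℕ< (n%ℕd<d x ℓ)))

  minV maxV : Vecℤ ℓ → ℤ
  minV a = foldr ℤ._⊓_ (a (fromℕ< (n%ℕd<d (+ 0) ℓ))) (map (λ n → a (fromℕ< (n%ℕd<d (+ n) ℓ))) (upTo ℓ))
  maxV a = foldr ℤ._⊔_ (a (fromℕ< (n%ℕd<d (+ 0) ℓ))) (map (λ n → a (fromℕ< (n%ℕd<d (+ n) ℓ))) (upTo ℓ))

  -- Every integer below lo = ℓ·min_j a_j lies in X(a), and no integer
  -- ≥ hi = ℓ·(max_j a_j + 1) lies in X(a).  Hence for x ∈ X(a) the number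
  -- |{y ∉ X(a) : y < x}| is 0 when x < lo, and equals the number of
  -- y ∈ [lo, x) with y ∉ X(a) otherwise.  We enumerate x = lo + k.
  lo hi : Vecℤ ℓ → ℤ
  lo a = + ℓ ℤ.* minV a
  hi a = + ℓ ℤ.* (maxV a ℤ.+ + 1)

  pos : Vecℤ ℓ → ℕ → ℤ
  pos a k = lo a ℤ.+ + k

  gapsBelow : Vecℤ ℓ → ℕ → ℕ
  gapsBelow a k = length (filterᵇ (λ k' → not (inX a (pos a k'))) (upTo k))

  -- π(a): the nonzero values of gapsBelow over x ∈ X(a), listed for x
  -- decreasing (which lists them in weakly decreasing order).
  π : Vecℤ ℓ → Partition
  π a = filterᵇ (λ n → not (does (n ℕ.≟ 0)))
          (map (gapsBelow a)
            (filterᵇ (λ k → inX a (pos a k)) (reverse (upTo ∣ hi a ℤ.- lo a ∣))))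

  boxRes : ℕ → ℕ → ℕ
  boxRes x y = (+ y ℤ.- + x) %ℕ ℓ

  -- rows of λ paired with their (1-based) row index
  indexedRows : Partition → List (ℕ × ℕ)
  indexedRows λ' = go 1 λ'
    where
    go : ℕ → List ℕ → List (ℕ × ℕ)
    go r []       = []
    go r (p ∷ ps) = (r , p) ∷ go (suc r) ps

  rowRes : ℕ × ℕ → ℕ
  rowRes (r , p) = boxRes r p

  -- residue of the rightmost box of the last nonzero row
  lastRes : Partition → ℕ
  lastRes λ' = foldr (λ rp _ → rowRes rp) 0 (reverse (indexedRows λ'))

  -- λ_{R(i)}: the length of the longest row whose rightmost box has
  -- residue i (0 if there is no such row)
  longestWithRes : Partition → ℕ → ℕ
  longestWithRes λ' i =
    foldr ℕ._⊔_ 0 (map (λ { (r , p) → p })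
      (filterᵇ (λ rp → does (rowRes rp ℕ.≟ i)) (indexedRows λ')))

  -- Σ_i λ_{R(i)} over the residues i ∈ {0,…,ℓ-1} occurring as residue of
  -- a rightmost box (residues not occurring contribute 0).
  resSum : Partition → ℕ
  resSum λ' = sum (map (longestWithRes λ') (upTo ℓ))

  -- The word w(λ), defined by the recursion
  --   w(∅) = empty word,
  --   w(λ) = s_i w(s_i(λ)) for λ ≠ ∅, i = residue of the rightmost box of
  --   the last nonzero row, s_i(λ) = π(s_i π⁻¹(λ)).
  -- WordOf λ w means "w is the word w(λ)"; π⁻¹(λ) is given by a vector
  -- a ∈ Λ_R with π(a) = λ (unique since π is a bijection).
  data WordOf : Partition → Word ℓ → Set where
    wEmpty : WordOf [] []
    wStep  : ∀ {λ' w} (i : Fin ℓ) (a : Vecℤ ℓ) → InΛR a → π a ≡ λ' →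
             λ' ≢ [] → toℕ i ≡ lastRes λ' →
             WordOf (π (gen i a)) w → WordOf λ' (i ∷ w)

{-# OPTIONS --safe #-}
module Submission where

-- Write G(a) = Σ_{j,k} max(0, a_j − a_k − [j ≤ k]) for a ∈ Λ_R (cosetLength below).  Each
-- generator s_i acts on a by exchanging two coordinates (with a unit shift for s_0), so only
-- the two terms of G indexed by that pair change, and G changes by at most one.  Since G(0) = 0
-- and every word u in the coset t_a S_ℓ sends 0 to a, every such word has length ≥ G(a).
--
-- On the abacus of a (runner j carries the beads r ℓ + j − 1 with r ≤ a_j), the rows of π(a)
-- are the gap counts below the beads, and a row ends in residue j exactly when its bead lies on
-- runner j.  The longest such row belongs to the top bead of runner j, and counting the gaps
-- below it runner by runner gives Σ_k max(0, a_j − a_k − [j ≤ k]); summing over j,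
-- Σ_i λ_{R(i)} = G(a).  The last row of π(a) ends at a bead preceded by a gap; the generator
-- for its residue moves that bead into the gap and lowers G by exactly one.  Since π is
-- injective, induction along the recursion gives that w(π(a)) lies in t_a S_ℓ and has length
-- G(a); being of minimal length in the coset, it is also reduced.

open import Algebra.Bundles using (CommutativeMonoid)
open import Data.Bool using (Bool; true; false; not; if_then_else_; T)
open import Data.Empty using (⊥; ⊥-elim)
open import Data.Fin as Fin using (Fin; toℕ; fromℕ; fromℕ<; inject₁; punchIn)
import Data.Fin.Properties as FinP
open import Data.Fin.Permutation.Components using (transpose)
open import Data.Integer as ℤ using (ℤ; +_; -[1+_]; _/ℕ_; _%ℕ_; ∣_∣)
import Data.Integer.Properties as ℤP
open import Data.Integer.DivMod using (n%ℕd<d; a≡a%ℕn+[a/ℕn]*n)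
open import Data.Integer.Tactic.RingSolver using (solve-∀)
open import Data.List using (List; []; _∷_; _++_; [_]; _∷ʳ_; length; map; filterᵇ; upTo; downFrom; applyUpTo; reverse; foldr)
import Data.List.Properties as ListP
open import Data.List.Membership.Propositional using (_∈_)
import Data.List.Relation.Unary.All as All
open import Data.List.Relation.Unary.All.Properties using (++⁺)
open import Data.List.Relation.Unary.Any using (here; there)
open import Data.Nat as ℕ using (ℕ; zero; suc)
import Data.Nat.ListAction
import Data.Nat.Properties as ℕP
open import Data.Product using (Σ; ∃; _×_; _,_; proj₁; proj₂)
open import Data.Sum using (_⊎_; inj₁; inj₂)
open import Data.Vec.Functional using (Vector; updateAt)
open import Data.Vec.Functional.Properties using (updateAt-updates; updateAt-minimal)
open import Function using (_∘_; _∘′_)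
open import Relation.Binary.Definitions using (tri<; tri≈; tri>)
open import Relation.Binary.PropositionalEquality hiding ([_])
open import Relation.Nullary using (¬_; Dec; yes; no; does)
open import Relation.Nullary.Decidable using (dec-true; dec-false)
open import Algebra.Properties.AbelianGroup ℤP.+-0-abelianGroup using (∙-cancelʳ)
open import Defs

-- Finite sums

module SumUpdate {c ℓ} (M : CommutativeMonoid c ℓ) where

  open CommutativeMonoid M using (Carrier; _≈_; assoc; ∙-congˡ; ∙-congʳ)
    renaming (_∙_ to _+_; refl to ≈-refl; sym to ≈-sym; trans to ≈-trans; reflexive to ≈-reflexive; setoid to ≈-setoid)
  open import Algebra.Properties.CommutativeMonoid.Sum M using (sum; sum-remove; sum-cong-≋)
  open import Algebra.Solver.CommutativeMonoid M using (solve; _⊕_; _⊜_)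
  open import Relation.Binary.Reasoning.Setoid ≈-setoid

  sum-updateAt : ∀ {n} (p : Fin n) {f g : Vector Carrier n} →
                 (∀ u → u ≢ p → f u ≈ g u) → sum f + g p ≈ sum g + f p
  sum-updateAt {suc n} p {f} {g} f≈g = begin
    sum f + g p                          ≈⟨ ∙-congʳ (sum-remove {i = p} f) ⟩
    f p + sum (f ∘ punchIn p) + g p      ≈⟨ ∙-congʳ (∙-congˡ (sum-cong-≋ (λ k → f≈g _ (FinP.punchInᵢ≢i p k)))) ⟩
    f p + sum (g ∘ punchIn p) + g p      ≈⟨ solve 3 (λ x s y → (x ⊕ s) ⊕ y ⊜ (y ⊕ s) ⊕ x) ≈-refl (f p) _ (g p) ⟩
    g p + sum (g ∘ punchIn p) + f p      ≈⟨ ∙-congʳ (≈-sym (sum-remove {i = p} g)) ⟩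
    sum g + f p                          ∎

  sum-updateAt₂ : ∀ {n} {p q : Fin n} {f g : Vector Carrier n} → p ≢ q →
                  (∀ u → u ≢ p → u ≢ q → f u ≈ g u) →
                  sum f + (g p + g q) ≈ sum g + (f p + f q)
  sum-updateAt₂ {n} {p} {q} {f} {g} p≢q f≈g = begin
    sum f + (g p + g q)  ≈⟨ ≈-sym (assoc _ _ _) ⟩
    sum f + g p + g q    ≈⟨ ∙-congʳ (∙-congˡ (≈-reflexive (sym (updateAt-updates p f)))) ⟩
    sum f + h p + g q    ≈⟨ ∙-congʳ (sum-updateAt p (λ u u≢p → ≈-reflexive (sym (updateAt-minimal u p f u≢p)))) ⟩
    sum h + f p + g q    ≈⟨ solve 3 (λ s x y → (s ⊕ x) ⊕ y ⊜ (s ⊕ y) ⊕ x) ≈-refl (sum h) (f p) (g q) ⟩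
    sum h + g q + f p    ≈⟨ ∙-congʳ (sum-updateAt q h≈g) ⟩
    sum g + h q + f p    ≈⟨ ∙-congʳ (∙-congˡ (≈-reflexive (updateAt-minimal q p f (p≢q ∘ sym)))) ⟩
    sum g + f q + f p    ≈⟨ solve 3 (λ s x y → (s ⊕ x) ⊕ y ⊜ s ⊕ (y ⊕ x)) ≈-refl (sum g) (f q) (f p) ⟩
    sum g + (f p + f q)  ∎
    where
    h : Vector Carrier n
    h = updateAt f p (λ _ → g p)
    h≈g : ∀ u → u ≢ q → h u ≈ g u
    h≈g u u≢q with u Fin.≟ p
    ... | yes refl = ≈-reflexive (updateAt-updates p f)
    ... | no u≢p   = ≈-trans (≈-reflexive (updateAt-minimal u p f u≢p)) (f≈g u u≢p u≢q)

module NatSum where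

  open import Data.Nat using (_+_)
  open import Algebra.Properties.CommutativeMonoid.Sum ℕP.+-0-commutativeMonoid public
    using (sum; sum-cong-≗; sum-replicate-zero; sum-syntax)
  open SumUpdate ℕP.+-0-commutativeMonoid public
  open import Data.Nat.Tactic.RingSolver using (solve)
  open import Data.List using (_∷_; [])

  sum≡0⇒≡0 : ∀ {n} (f : Fin n → ℕ) → sum f ≡ 0 → ∀ u → f u ≡ 0
  sum≡0⇒≡0 {suc n} f eq Fin.zero    = ℕP.m+n≡0⇒m≡0 (f Fin.zero) eq
  sum≡0⇒≡0 {suc n} f eq (Fin.suc u) = sum≡0⇒≡0 (f ∘ Fin.suc) (ℕP.m+n≡0⇒n≡0 (f Fin.zero) eq) u

  ≡0⇒sum≡0 : ∀ {n} (f : Fin n → ℕ) → (∀ u → f u ≡ 0) → sum f ≡ 0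
  ≡0⇒sum≡0 {n} f f≡0 = trans (sum-cong-≗ f≡0) (sum-replicate-zero n)

  sum₂ : ∀ {n} → (Fin n → Fin n → ℕ) → ℕ
  sum₂ F = sum (λ u → sum (F u))

  private
    rebalance : ∀ X′ X Rp Rq R′p R′q a b c d →
      X′ + (Rp + Rq) ≡ X + (R′p + R′q) → R′p + a ≡ Rq + c → R′q + b ≡ Rp + d →
      X′ + (b + a) ≡ X + (c + d)
    rebalance X′ X Rp Rq R′p R′q a b c d outer rowp rowq = ℕP.+-cancelʳ-≡ (Rp + Rq) _ _ (begin
      X′ + (b + a) + (Rp + Rq)         ≡⟨ solve (X′ ∷ Rp ∷ Rq ∷ a ∷ b ∷ []) ⟩
      X′ + (Rp + Rq) + (b + a)         ≡⟨ cong (_+ (b + a)) outer ⟩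
      X + (R′p + R′q) + (b + a)        ≡⟨ solve (X ∷ R′p ∷ R′q ∷ a ∷ b ∷ []) ⟩
      X + ((R′p + a) + (R′q + b))      ≡⟨ cong₂ (λ y z → X + (y + z)) rowp rowq ⟩
      X + ((Rq + c) + (Rp + d))        ≡⟨ solve (X ∷ Rp ∷ Rq ∷ c ∷ d ∷ []) ⟩
      X + (c + d) + (Rp + Rq)          ∎)
      where open ≡-Reasoning

  sum₂-transpose : ∀ {n} {p q : Fin n} (F F′ : Fin n → Fin n → ℕ) → p ≢ q →
    (∀ u v → u ≢ p → u ≢ q → v ≢ p → v ≢ q → F′ u v ≡ F u v) →
    (∀ u → u ≢ p → u ≢ q → F′ u p ≡ F u q) →
    (∀ u → u ≢ p → u ≢ q → F′ u q ≡ F u p) →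
    (∀ v → v ≢ p → v ≢ q → F′ p v ≡ F q v) →
    (∀ v → v ≢ p → v ≢ q → F′ q v ≡ F p v) →
    F p p ≡ 0 → F q q ≡ 0 → F′ p p ≡ 0 → F′ q q ≡ 0 →
    sum₂ F′ + (F p q + F q p) ≡ sum₂ F + (F′ p q + F′ q p)
  sum₂-transpose {n} {p} {q} F F′ p≢q same colp colq rowp rowq Fpp Fqq F′pp F′qq =
    rebalance (sum₂ F′) (sum₂ F) (R p) (R q) (R′ p) (R′ q) _ _ _ _
      (sum-updateAt₂ {f = R′} {g = R} p≢q R′≡R) row-p row-q
    where
    R R′ : Fin n → ℕ
    R u = sum (F u)
    R′ u = sum (F′ u)
    R′≡R : ∀ u → u ≢ p → u ≢ q → R′ u ≡ R u
    R′≡R u u≢p u≢q = ℕP.+-cancelʳ-≡ (F u p + F u q) _ _ (begin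
      R′ u + (F u p + F u q)    ≡⟨ sum-updateAt₂ p≢q (λ v v≢p v≢q → same u v u≢p u≢q v≢p v≢q) ⟩
      R u + (F′ u p + F′ u q)   ≡⟨ cong₂ (λ y z → R u + (y + z)) (colp u u≢p u≢q) (colq u u≢p u≢q) ⟩
      R u + (F u q + F u p)     ≡⟨ cong (λ z → R u + z) (ℕP.+-comm (F u q) (F u p)) ⟩
      R u + (F u p + F u q)     ∎)
      where open ≡-Reasoning
    row-p : R′ p + F q p ≡ R q + F′ p q
    row-p = trans (cong (λ z → R′ p + z) (sym (ℕP.+-identityʳ (F q p)))) (subst₂
      (λ x y → R′ p + (F q p + x) ≡ R q + (y + F′ p q)) Fqq F′pp
      (sum-updateAt₂ {f = F′ p} {g = F q} p≢q rowp))
    row-q : R′ q + F p q ≡ R p + F′ q p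
    row-q = trans (subst₂
      (λ x y → R′ q + (x + F p q) ≡ R p + (F′ q p + y)) Fpp F′qq
      (sum-updateAt₂ {f = F′ q} {g = F p} p≢q rowq)) (cong (λ z → R p + z) (ℕP.+-identityʳ (F′ q p)))

private
  module ℤΣ where
    open import Algebra.Properties.CommutativeMonoid.Sum ℤP.+-0-commutativeMonoid public using (sum)
    open SumUpdate ℤP.+-0-commutativeMonoid public

sumℤ≡sum : ∀ {N} (a : Vecℤ N) → sumℤ a ≡ ℤΣ.sum a
sumℤ≡sum {zero}  a = refl
sumℤ≡sum {suc N} a = cong (λ s → a Fin.zero ℤ.+ s) (sumℤ≡sum (a ∘ Fin.suc))

sumℤ-exchange : ∀ {N} {p q : Fin N} {f g : Vecℤ N} → p ≢ q →
                (∀ u → u ≢ p → u ≢ q → f u ≡ g u) → f p ℤ.+ f q ≡ g p ℤ.+ g q → sumℤ f ≡ sumℤ g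
sumℤ-exchange {p = p} {q} {f} {g} p≢q f≗g pair≡ = begin
  sumℤ f    ≡⟨ sumℤ≡sum f ⟩
  ℤΣ.sum f  ≡⟨ ∙-cancelʳ (g p ℤ.+ g q) _ _ (trans (ℤΣ.sum-updateAt₂ p≢q f≗g) (cong (λ s → ℤΣ.sum g ℤ.+ s) pair≡)) ⟩
  ℤΣ.sum g  ≡⟨ sumℤ≡sum g ⟨
  sumℤ g    ∎
  where open ≡-Reasoning

sumℤ-nonneg : ∀ {N} (f : Vecℤ N) → (∀ j → + 0 ℤ.≤ f j) → + 0 ℤ.≤ sumℤ f
sumℤ-nonneg {zero}  f 0≤f = ℤP.≤-refl
sumℤ-nonneg {suc N} f 0≤f = ℤP.+-mono-≤ (0≤f Fin.zero) (sumℤ-nonneg (f ∘ Fin.suc) (0≤f ∘ Fin.suc))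

sumℤ≡0-nonneg : ∀ {N} (f : Vecℤ N) → (∀ j → + 0 ℤ.≤ f j) → sumℤ f ≡ + 0 → ∀ j → f j ≡ + 0
sumℤ≡0-nonneg {suc N} f 0≤f sum≡0 = cases
  where
  f₀ : ℤ
  f₀ = f Fin.zero
  rest : ℤ
  rest = sumℤ (f ∘ Fin.suc)
  f₀≡0 : f₀ ≡ + 0
  f₀≡0 = ℤP.≤-antisym (subst (f₀ ℤ.≤_) sum≡0 (subst (ℤ._≤ f₀ ℤ.+ rest) (ℤP.+-identityʳ f₀)
    (ℤP.+-monoʳ-≤ f₀ (sumℤ-nonneg (f ∘ Fin.suc) (0≤f ∘ Fin.suc))))) (0≤f Fin.zero)
  rest≡0 : rest ≡ + 0
  rest≡0 = trans (sym (ℤP.+-identityˡ rest)) (trans (cong (ℤ._+ rest) (sym f₀≡0)) sum≡0)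
  cases : ∀ j → f j ≡ + 0
  cases Fin.zero    = f₀≡0
  cases (Fin.suc j) = sumℤ≡0-nonneg (f ∘ Fin.suc) (0≤f ∘ Fin.suc) rest≡0 j

sumℤ-neg : ∀ {N} (f : Vecℤ N) → sumℤ (λ j → ℤ.- f j) ≡ ℤ.- sumℤ f
sumℤ-neg {zero}  f = refl
sumℤ-neg {suc N} f = trans (cong (λ s → ℤ.- f Fin.zero ℤ.+ s) (sumℤ-neg (f ∘ Fin.suc))) (sym (ℤP.neg-distrib-+ (f Fin.zero) _))

sumℤ≡0-nonpos : ∀ {N} (f : Vecℤ N) → (∀ j → f j ℤ.≤ + 0) → sumℤ f ≡ + 0 → ∀ j → f j ≡ + 0
sumℤ≡0-nonpos f f≤0 sum≡0 j = trans (sym (ℤP.neg-involutive (f j))) (cong ℤ.-_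
  (sumℤ≡0-nonneg (λ j → ℤ.- f j) (λ j → ℤP.neg-mono-≤ (f≤0 j)) (trans (sumℤ-neg f) (cong ℤ.-_ sum≡0)) j))

sumℤ-cong : ∀ {N} {f g : Vecℤ N} → (∀ j → f j ≡ g j) → sumℤ f ≡ sumℤ g
sumℤ-cong {zero}  f≗g = refl
sumℤ-cong {suc N} f≗g = cong₂ ℤ._+_ (f≗g Fin.zero) (sumℤ-cong (f≗g ∘ Fin.suc))

sumℤ-+ : ∀ {N} (f : Fin N → ℕ) → sumℤ (λ j → + f j) ≡ + NatSum.sum f
sumℤ-+ {zero}  f = refl
sumℤ-+ {suc N} f = trans (cong (λ s → + f Fin.zero ℤ.+ s) (sumℤ-+ (f ∘ Fin.suc))) (sym (ℤP.pos-+ (f Fin.zero) _))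

sumℤ-const-minus : ∀ {N} (c : ℤ) (a : Vecℤ N) → sumℤ (λ j → c ℤ.- a j) ≡ + N ℤ.* c ℤ.- sumℤ a
sumℤ-const-minus {zero}  c a = refl
sumℤ-const-minus {suc N} c a = trans (cong (λ s → c ℤ.- a Fin.zero ℤ.+ s) (sumℤ-const-minus c (a ∘ Fin.suc)))
  (regroup c (a Fin.zero) (+ N) (sumℤ (a ∘ Fin.suc)))
  where regroup : ∀ c x N s → c ℤ.- x ℤ.+ (N ℤ.* c ℤ.- s) ≡ (+ 1 ℤ.+ N) ℤ.* c ℤ.- (x ℤ.+ s)
        regroup = solve-∀

sumℤ-≤ : ∀ {N} (f : Vecℤ N) c → (∀ j → f j ℤ.≤ c) → sumℤ f ℤ.≤ + N ℤ.* c
sumℤ-≤ {zero}  f c f≤c = ℤP.≤-refl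
sumℤ-≤ {suc N} f c f≤c = subst (sumℤ f ℤ.≤_) (regroup (+ N) c) (ℤP.+-mono-≤ (f≤c Fin.zero) (sumℤ-≤ (f ∘ Fin.suc) c (f≤c ∘ Fin.suc)))
  where regroup : ∀ N c → c ℤ.+ N ℤ.* c ≡ (+ 1 ℤ.+ N) ℤ.* c
        regroup = solve-∀

foldr-⊓-applyUpTo-≤ : ∀ (f : ℕ → ℤ) {N} d {k} → k ℕ.< N → foldr ℤ._⊓_ d (applyUpTo f N) ℤ.≤ f k
foldr-⊓-applyUpTo-≤ f {suc N} d {zero}  _   = ℤP.i⊓j≤i (f 0) _
foldr-⊓-applyUpTo-≤ f {suc N} d {suc k} k<N =
  ℤP.≤-trans (ℤP.i⊓j≤j (f 0) _) (foldr-⊓-applyUpTo-≤ (f ∘ suc) d (ℕ.s≤s⁻¹ k<N))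

foldr-⊔-applyUpTo-≥ : ∀ (f : ℕ → ℤ) {N} d {k} → k ℕ.< N → f k ℤ.≤ foldr ℤ._⊔_ d (applyUpTo f N)
foldr-⊔-applyUpTo-≥ f {suc N} d {zero}  _   = ℤP.i≤i⊔j (f 0) _
foldr-⊔-applyUpTo-≥ f {suc N} d {suc k} k<N =
  ℤP.≤-trans (foldr-⊔-applyUpTo-≥ (f ∘ suc) d (ℕ.s≤s⁻¹ k<N)) (ℤP.i≤j⊔i (f 0) _)

length-filterᵇ-∷ʳ : ∀ {A : Set} (p : A → Bool) xs x →
                    length (filterᵇ p (xs ∷ʳ x)) ≡ length (filterᵇ p xs) ℕ.+ (if p x then 1 else 0)
length-filterᵇ-∷ʳ p []       x with p x
... | true  = refl
... | false = refl
length-filterᵇ-∷ʳ p (y ∷ xs) x with p y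
... | true  = cong suc (length-filterᵇ-∷ʳ p xs x)
... | false = length-filterᵇ-∷ʳ p xs x

lastOf : ∀ {A : Set} → A → List A → A
lastOf x []       = x
lastOf x (y ∷ ys) = lastOf y ys

foldr-const-reverse : ∀ {A B : Set} (f : A → B) (x : A) xs (d : B) →
                      foldr (λ z _ → f z) d (reverse (x ∷ xs)) ≡ f (lastOf x xs)
foldr-const-reverse f x []       d = refl
foldr-const-reverse {A} {B} f x (y ∷ ys) d = begin
  foldr h d (reverse (x ∷ y ∷ ys))      ≡⟨ cong (foldr h d) (ListP.unfold-reverse x (y ∷ ys)) ⟩
  foldr h d (reverse (y ∷ ys) ++ [ x ]) ≡⟨ ListP.foldr-++ h d (reverse (y ∷ ys)) [ x ] ⟩
  foldr h (f x) (reverse (y ∷ ys))      ≡⟨ foldr-const-reverse f y ys (f x) ⟩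
  f (lastOf y ys)                       ∎
  where
  open ≡-Reasoning
  h : A → B → B
  h z _ = f z

foldr-const-< : ∀ {A : Set} {N} (f : A → ℕ) {d} → (∀ x → f x ℕ.< N) → d ℕ.< N → ∀ xs → foldr (λ x _ → f x) d xs ℕ.< N
foldr-const-< f f<N d<N []       = d<N
foldr-const-< f f<N d<N (x ∷ xs) = f<N x

foldr-⊔-filterᵇ-≤ : ∀ {A : Set} (f : A → ℕ) (q : A → Bool) xs {V} → (∀ x → x ∈ xs → q x ≡ true → f x ℕ.≤ V) →
                    foldr ℕ._⊔_ 0 (map f (filterᵇ q xs)) ℕ.≤ V
foldr-⊔-filterᵇ-≤ f q []       f≤V = ℕ.z≤n
foldr-⊔-filterᵇ-≤ f q (y ∷ xs) f≤V with q y in qy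
... | true  = ℕP.⊔-lub (f≤V y (here refl) qy) (foldr-⊔-filterᵇ-≤ f q xs (λ x x∈ → f≤V x (there x∈)))
... | false = foldr-⊔-filterᵇ-≤ f q xs (λ x x∈ → f≤V x (there x∈))

≤-foldr-⊔-filterᵇ : ∀ {A : Set} (f : A → ℕ) (q : A → Bool) xs {x} → x ∈ xs → q x ≡ true →
                    f x ℕ.≤ foldr ℕ._⊔_ 0 (map f (filterᵇ q xs))
≤-foldr-⊔-filterᵇ f q (y ∷ xs) (here refl) qx rewrite qx = ℕP.m≤m⊔n (f y) _
≤-foldr-⊔-filterᵇ f q (y ∷ xs) (there x∈) qx with q y
... | true  = ℕP.≤-trans (≤-foldr-⊔-filterᵇ f q xs x∈ qx) (ℕP.m≤n⊔m (f y) _)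
... | false = ≤-foldr-⊔-filterᵇ f q xs x∈ qx

indexed : ℕ → List ℕ → List (ℕ × ℕ)
indexed r []       = []
indexed r (p ∷ ps) = (r , p) ∷ indexed (suc r) ps

∷≢[] : ∀ {A : Set} {x : A} {xs} → x ∷ xs ≢ []
∷≢[] ()

true≢false : true ≢ false
true≢false ()

nonzero : ℕ → Bool
nonzero x = not (does (x ℕ.≟ 0))

module _ {k : ℕ} {A : Set} where

  if-≟-refl : ∀ {t e : A} (x : Fin k) → (if does (x Fin.≟ x) then t else e) ≡ t
  if-≟-refl x = cong (if_then _ else _) (dec-true (x Fin.≟ x) refl)

  if-≟-≢ : ∀ {x y : Fin k} {t e : A} → x ≢ y → (if does (x Fin.≟ y) then t else e) ≡ e
  if-≟-≢ {x} {y} x≢y = cong (if_then _ else _) (dec-false (x Fin.≟ y) x≢y)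

module _ {k : ℕ} where

  transpose-matchˡ : ∀ (i j : Fin k) → transpose i j i ≡ j
  transpose-matchˡ i j rewrite dec-true (i Fin.≟ i) refl = refl

  transpose-matchʳ : ∀ {i j : Fin k} → i ≢ j → transpose i j j ≡ i
  transpose-matchʳ {i} {j} i≢j rewrite dec-false (j Fin.≟ i) (i≢j ∘ sym) | dec-true (j Fin.≟ j) refl = refl

  transpose-other : ∀ {i j x : Fin k} → x ≢ i → x ≢ j → transpose i j x ≡ x
  transpose-other {i} {j} {x} x≢i x≢j rewrite dec-false (x Fin.≟ i) x≢i | dec-false (x Fin.≟ j) x≢j = refl

  transpose-involutive : ∀ {i j : Fin k} → i ≢ j → ∀ x → transpose i j (transpose i j x) ≡ x
  transpose-involutive {i} {j} i≢j x = cases x (x Fin.≟ i) (x Fin.≟ j)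
    where
    cases : ∀ x → Dec (x ≡ i) → Dec (x ≡ j) → transpose i j (transpose i j x) ≡ x
    cases .i (yes refl) _ = trans (cong (transpose i j) (transpose-matchˡ i j)) (transpose-matchʳ i≢j)
    cases .j (no _) (yes refl) = trans (cong (transpose i j) (transpose-matchʳ i≢j)) (transpose-matchˡ i j)
    cases x (no x≢i) (no x≢j) = trans (cong (transpose i j) (transpose-other x≢i x≢j)) (transpose-other x≢i x≢j)

  transpose-conjugate : ∀ {A B C : Fin k} → A ≢ B → A ≢ C → B ≢ C → ∀ x →
                        transpose B C (transpose A B (transpose B C x)) ≡ transpose A C x
  transpose-conjugate {A} {B} {C} A≢B A≢C B≢C x = cases x (x Fin.≟ A) (x Fin.≟ B) (x Fin.≟ C)
    where
    cases : ∀ x → Dec (x ≡ A) → Dec (x ≡ B) → Dec (x ≡ C) →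
            transpose B C (transpose A B (transpose B C x)) ≡ transpose A C x
    cases .A (yes refl) _ _ = begin
      transpose B C (transpose A B (transpose B C A)) ≡⟨ cong (transpose B C ∘ transpose A B) (transpose-other A≢B A≢C) ⟩
      transpose B C (transpose A B A)                 ≡⟨ cong (transpose B C) (transpose-matchˡ A B) ⟩
      transpose B C B                                 ≡⟨ transpose-matchˡ B C ⟩
      C                                               ≡⟨ transpose-matchˡ A C ⟨
      transpose A C A                                 ∎
      where open ≡-Reasoning
    cases .B (no _) (yes refl) _ = begin
      transpose B C (transpose A B (transpose B C B)) ≡⟨ cong (transpose B C ∘ transpose A B) (transpose-matchˡ B C) ⟩
      transpose B C (transpose A B C)                 ≡⟨ cong (transpose B C) (transpose-other (A≢C ∘ sym) (B≢C ∘ sym)) ⟩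
      transpose B C C                                 ≡⟨ transpose-matchʳ B≢C ⟩
      B                                               ≡⟨ transpose-other (A≢B ∘ sym) B≢C ⟨
      transpose A C B                                 ∎
      where open ≡-Reasoning
    cases .C (no _) (no _) (yes refl) = begin
      transpose B C (transpose A B (transpose B C C)) ≡⟨ cong (transpose B C ∘ transpose A B) (transpose-matchʳ B≢C) ⟩
      transpose B C (transpose A B B)                 ≡⟨ cong (transpose B C) (transpose-matchʳ A≢B) ⟩
      transpose B C A                                 ≡⟨ transpose-other A≢B A≢C ⟩
      A                                               ≡⟨ transpose-matchʳ A≢C ⟨
      transpose A C C                                 ∎
      where open ≡-Reasoning
    cases x (no x≢A) (no x≢B) (no x≢C) = begin
      transpose B C (transpose A B (transpose B C x)) ≡⟨ cong (transpose B C ∘ transpose A B) (transpose-other x≢B x≢C) ⟩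
      transpose B C (transpose A B x)                 ≡⟨ cong (transpose B C) (transpose-other x≢A x≢B) ⟩
      transpose B C x                                 ≡⟨ transpose-other x≢B x≢C ⟩
      x                                               ≡⟨ transpose-other x≢A x≢C ⟨
      transpose A C x                                 ∎
      where open ≡-Reasoning

-- Positive parts

posPart : ℤ → ℕ
posPart (+ n)    = n
posPart -[1+ n ] = 0

posPart-nonpos : ∀ {z} → z ℤ.≤ + 0 → posPart z ≡ 0
posPart-nonpos {+ zero}   _ = refl
posPart-nonpos { -[1+ _ ]} _ = refl
posPart-nonpos {+ suc _} (ℤ.+≤+ ())

posPart≡0⇒nonpos : ∀ z → posPart z ≡ 0 → z ℤ.≤ + 0
posPart≡0⇒nonpos (+ zero)   _ = ℤP.≤-refl
posPart≡0⇒nonpos -[1+ _ ]   _ = ℤ.-≤+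

posPart-pred : ∀ (Q x : ℤ) → posPart (Q ℤ.- x) ≡ posPart (Q ℤ.- x ℤ.- + 1) ℕ.+ (if does (Q ℤ.≤? x) then 0 else 1)
posPart-pred Q x with Q ℤ.≤? x
... | yes Q≤x = trans (posPart-nonpos (ℤP.i≤j⇒i-j≤0 Q≤x)) (sym (trans (ℕP.+-identityʳ _)
                  (posPart-nonpos (ℤP.≤-trans (ℤP.i-j≤i (Q ℤ.- x) (+ 1)) (ℤP.i≤j⇒i-j≤0 Q≤x)))))
... | no Q≰x  = positive (Q ℤ.- x) (ℤP.i<j⇒suc[i]≤j (subst (ℤ._< Q ℤ.- x) (ℤP.+-inverseʳ x) (ℤP.+-monoˡ-< (ℤ.- x) (ℤP.≰⇒> Q≰x))))
  where
  positive : ∀ z → + 1 ℤ.≤ z → posPart z ≡ posPart (z ℤ.- + 1) ℕ.+ 1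
  positive (+ suc t) _ = ℕP.+-comm 1 t
  positive (+ zero) (ℤ.+≤+ ())

posPart-nonneg : ∀ {z} → + 0 ℤ.≤ z → + posPart z ≡ z
posPart-nonneg {+ _} _ = refl

-- excess a p q + excess a q p for p before q, as a function of d = a p − a q
pairExcess : ℤ → ℕ
pairExcess d = posPart (d ℤ.- + 1) ℕ.+ posPart (ℤ.- d)

pairExcess-neg-≤ : ∀ d → pairExcess (ℤ.- d) ℕ.≤ pairExcess d ℕ.+ 1
pairExcess-neg-≤ (+ zero)  = ℕ.z≤n
pairExcess-neg-≤ (+ suc k) rewrite ℕP.+-identityʳ k = ℕP.≤-reflexive (ℕP.+-comm 1 k)
pairExcess-neg-≤ -[1+ k ]  rewrite ℕP.+-identityʳ k = ℕP.≤-trans (ℕP.n≤1+n k) (ℕP.m≤m+n (suc k) 1)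

pairExcess-neg : ∀ {d} → d ℤ.< + 0 → pairExcess (ℤ.- d) ℕ.+ 1 ≡ pairExcess d
pairExcess-neg { -[1+ k ]} _ rewrite ℕP.+-identityʳ k = ℕP.+-comm k 1
pairExcess-neg {+ _} (ℤ.+<+ ())

pairExcess-pred-≤ : ∀ d → pairExcess (d ℤ.- + 1) ℕ.≤ pairExcess d ℕ.+ 1
pairExcess-pred-≤ (+ zero)        = ℕP.≤-refl
pairExcess-pred-≤ (+ suc zero)    = ℕ.z≤n
pairExcess-pred-≤ (+ suc (suc k)) rewrite ℕP.+-identityʳ k = ℕP.≤-trans (ℕP.n≤1+n k) (ℕP.m≤m+n (suc k) 1)
pairExcess-pred-≤ -[1+ k ] rewrite ℕP.+-identityʳ k | ℕP.+-comm k 1 = ℕP.≤-refl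

pairExcess-pred : ∀ {d} → + 2 ℤ.≤ d → pairExcess (d ℤ.- + 1) ℕ.+ 1 ≡ pairExcess d
pairExcess-pred {+ suc (suc k)} _ rewrite ℕP.+-identityʳ k = ℕP.+-comm k 1
pairExcess-pred {+ zero} (ℤ.+≤+ ())
pairExcess-pred {+ suc zero} (ℤ.+≤+ (ℕ.s≤s ()))

module BeadSequence (b : ℕ → Bool) where

  open import Data.Nat using (_+_; _≤_; _<_; s≤s)
  open import Data.Nat.Properties

  gaps beads : ℕ → ℕ
  gaps k  = length (filterᵇ (λ k′ → not (b k′)) (upTo k))
  beads k = length (filterᵇ b (upTo k))

  rows : ℕ → List ℕ
  rows n = filterᵇ nonzero (map gaps (filterᵇ b (downFrom n)))

  private
    count-∷ʳ : ∀ (p : ℕ → Bool) k → length (filterᵇ p (upTo (suc k))) ≡ length (filterᵇ p (upTo k)) + (if p k then 1 else 0)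
    count-∷ʳ p k = trans (cong (length ∘′ filterᵇ p) (sym (ListP.upTo-∷ʳ k))) (length-filterᵇ-∷ʳ p (upTo k) k)

  gaps-bead : ∀ {k} → b k ≡ true → gaps (suc k) ≡ gaps k
  gaps-bead {k} bk = trans (count-∷ʳ (λ k′ → not (b k′)) k) (trans (cong (λ c → gaps k + (if not c then 1 else 0)) bk) (+-identityʳ _))

  gaps-gap : ∀ {k} → b k ≡ false → gaps (suc k) ≡ suc (gaps k)
  gaps-gap {k} bk = trans (count-∷ʳ (λ k′ → not (b k′)) k) (trans (cong (λ c → gaps k + (if not c then 1 else 0)) bk) (+-comm (gaps k) 1))

  beads-bead : ∀ {k} → b k ≡ true → beads (suc k) ≡ suc (beads k)
  beads-bead {k} bk = trans (count-∷ʳ b k) (trans (cong (λ c → beads k + (if c then 1 else 0)) bk) (+-comm (beads k) 1))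

  beads-gap : ∀ {k} → b k ≡ false → beads (suc k) ≡ beads k
  beads-gap {k} bk = trans (count-∷ʳ b k) (trans (cong (λ c → beads k + (if c then 1 else 0)) bk) (+-identityʳ _))

  gaps+beads : ∀ k → gaps k + beads k ≡ k
  gaps+beads zero = refl
  gaps+beads (suc k) with b k in bk
  ... | true  = trans (cong₂ _+_ (gaps-bead bk) (beads-bead bk)) (trans (+-suc (gaps k) (beads k)) (cong suc (gaps+beads k)))
  ... | false = trans (cong₂ _+_ (gaps-gap bk) (beads-gap bk)) (cong suc (gaps+beads k))

  gaps-≤-suc : ∀ k → gaps k ≤ gaps (suc k)
  gaps-≤-suc k with b k in bk
  ... | true  = ≤-reflexive (sym (gaps-bead bk))
  ... | false = ≤-trans (n≤1+n _) (≤-reflexive (sym (gaps-gap bk)))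

  gaps-mono : ∀ {k k′} → k ≤ k′ → gaps k ≤ gaps k′
  gaps-mono {k} k≤k′ = go (≤⇒≤′ k≤k′)
    where
    go : ∀ {k′} → k ℕ.≤′ k′ → gaps k ≤ gaps k′
    go ℕ.≤′-refl        = ≤-refl
    go (ℕ.≤′-step {k′} p) = ≤-trans (go p) (gaps-≤-suc k′)

  beads≤ : ∀ k → beads k ≤ k
  beads≤ k = subst (beads k ≤_) (gaps+beads k) (m≤n+m (beads k) (gaps k))

  gaps≡0-below : ∀ {k n} → k < n → gaps n ≡ 0 → gaps k ≡ 0
  gaps≡0-below k<n gn≡0 = n≤0⇒n≡0 (≤-trans (gaps-mono (<⇒≤ k<n)) (≤-reflexive gn≡0))

  data RowStep (n : ℕ) : Set where
    new-row  : b n ≡ true → gaps n ≢ 0 → rows (suc n) ≡ gaps n ∷ rows n → RowStep n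
    zero-row : b n ≡ true → gaps n ≡ 0 → rows (suc n) ≡ rows n → RowStep n
    gap      : b n ≡ false → rows (suc n) ≡ rows n → RowStep n

  private
    rows-suc : ∀ n → rows (suc n) ≡ (if b n then (if nonzero (gaps n) then gaps n ∷ rows n else rows n) else rows n)
    rows-suc n with b n
    ... | false = refl
    ... | true with nonzero (gaps n)
    ...   | true  = refl
    ...   | false = refl

    onBead : ℕ → List ℕ
    onBead n = if nonzero (gaps n) then gaps n ∷ rows n else rows n

    rows-suc-bead : ∀ {n} → b n ≡ true → rows (suc n) ≡ onBead n
    rows-suc-bead {n} bn = trans (rows-suc n) (cong (if_then onBead n else rows n) bn)

  rows-suc-gap : ∀ {n} → b n ≡ false → rows (suc n) ≡ rows n
  rows-suc-gap {n} bn = trans (rows-suc n) (cong (if_then onBead n else rows n) bn)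

  rows-suc-zero : ∀ {n} → b n ≡ true → gaps n ≡ 0 → rows (suc n) ≡ rows n
  rows-suc-zero {n} bn gn≡0 = trans (rows-suc-bead bn) (cong (λ g → if nonzero g then gaps n ∷ rows n else rows n) gn≡0)

  rows-suc-nonzero : ∀ {n g} → b n ≡ true → gaps n ≡ suc g → rows (suc n) ≡ gaps n ∷ rows n
  rows-suc-nonzero {n} bn gn≡1+g = trans (rows-suc-bead bn) (cong (λ g → if nonzero g then gaps n ∷ rows n else rows n) gn≡1+g)

  rowStep : ∀ n → RowStep n
  rowStep n = cases (b n) refl
    where
    cases : ∀ c → b n ≡ c → RowStep n
    cases false bn = gap bn (rows-suc-gap bn)
    cases true  bn with gaps n in gn
    ... | zero  = zero-row bn gn (rows-suc-zero bn gn)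
    ... | suc _ = new-row bn (λ gn≡0 → 0≢1+n (trans (sym gn≡0) gn)) (rows-suc-nonzero bn gn)

  rows-empty : ∀ k → gaps k ≡ 0 → rows k ≡ []
  rows-empty zero _ = refl
  rows-empty (suc k) gk≡0 with rowStep k
  ... | new-row _ gk≢0 _ = ⊥-elim (gk≢0 (n≤0⇒n≡0 (≤-trans (gaps-≤-suc k) (≤-reflexive gk≡0))))
  ... | zero-row _ gk eq = trans eq (rows-empty k gk)
  ... | gap bk _         = ⊥-elim (0≢1+n (trans (sym gk≡0) (gaps-gap bk)))

  -- row r of indexed s (rows n) has length p and comes from the bead at bead-at, below r − s other beads
  record RowSource (s n r p : ℕ) : Set where
    field
      bead-at : ℕ
      bead<n  : bead-at < n
      bead    : b bead-at ≡ true
      gaps≡   : gaps bead-at ≡ p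
      p≢0     : p ≢ 0
      index≡  : r + beads (suc bead-at) ≡ s + beads n

  private
    extend-bead : ∀ {s n r p} → b n ≡ true → RowSource (suc s) n r p → RowSource s (suc n) r p
    extend-bead {s} {n} bn src = record
      { bead-at = bead-at ; bead<n = m≤n⇒m≤1+n bead<n ; bead = bead ; gaps≡ = gaps≡ ; p≢0 = p≢0
      ; index≡ = trans index≡ (trans (sym (+-suc s (beads n))) (cong (λ z → s + z) (sym (beads-bead bn)))) }
      where open RowSource src

    extend-gap : ∀ {s n r p} → b n ≡ false → RowSource s n r p → RowSource s (suc n) r p
    extend-gap {s} bn src = record
      { bead-at = bead-at ; bead<n = m≤n⇒m≤1+n bead<n ; bead = bead ; gaps≡ = gaps≡ ; p≢0 = p≢0
      ; index≡ = trans index≡ (cong (λ z → s + z) (sym (beads-gap bn))) }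
      where open RowSource src

    no-source-below-zero-row : ∀ {s n r p} → gaps n ≡ 0 → RowSource s n r p → ⊥
    no-source-below-zero-row gn≡0 src = p≢0 (trans (sym gaps≡) (gaps≡0-below bead<n gn≡0))
      where open RowSource src

  rows-source : ∀ n s {r p} → (r , p) ∈ indexed s (rows n) → RowSource s n r p
  rows-source (suc n) s {r} {p} r,p∈ with rowStep n
  ... | new-row bn gn≢0 eq with subst (λ L → (r , p) ∈ indexed s L) eq r,p∈
  ...   | here refl = record { bead-at = n ; bead<n = ≤-refl ; bead = bn ; gaps≡ = refl ; p≢0 = gn≢0 ; index≡ = refl }
  ...   | there r,p∈′ = extend-bead bn (rows-source n (suc s) r,p∈′)
  rows-source (suc n) s {r} {p} r,p∈ | zero-row _ gn≡0 eq =
    ⊥-elim (no-source-below-zero-row gn≡0 (rows-source n s (subst (λ L → (r , p) ∈ indexed s L) eq r,p∈)))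
  rows-source (suc n) s {r} {p} r,p∈ | gap bn eq =
    extend-gap bn (rows-source n s (subst (λ L → (r , p) ∈ indexed s L) eq r,p∈))

  bead-row : ∀ n s {k} → k < n → b k ≡ true → gaps k ≢ 0 →
             ∃ λ r → (r , gaps k) ∈ indexed s (rows n) × r + beads (suc k) ≡ s + beads n
  bead-row (suc n) s {k} k<1+n bk gk≢0 with m<1+n⇒m<n∨m≡n k<1+n | rowStep n
  ... | inj₂ refl | new-row _ _ eq = s , subst (λ L → (s , gaps n) ∈ indexed s L) (sym eq) (here refl) , refl
  ... | inj₂ refl | zero-row _ gn≡0 _ = ⊥-elim (gk≢0 gn≡0)
  ... | inj₂ refl | gap bn _ = ⊥-elim (true≢false (trans (sym bk) bn))
  ... | inj₁ k<n | new-row bn _ eq with bead-row n (suc s) k<n bk gk≢0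
  ...   | r , r∈ , index≡ = r , subst (λ L → (r , gaps k) ∈ indexed s L) (sym eq) (there r∈) ,
          trans index≡ (trans (sym (+-suc s (beads n))) (cong (λ z → s + z) (sym (beads-bead bn))))
  bead-row (suc n) s {k} k<1+n bk gk≢0 | inj₁ k<n | zero-row _ gn≡0 _ = ⊥-elim (gk≢0 (gaps≡0-below k<n gn≡0))
  bead-row (suc n) s {k} k<1+n bk gk≢0 | inj₁ k<n | gap bn eq with bead-row n s k<n bk gk≢0
  ... | r , r∈ , index≡ = r , subst (λ L → (r , gaps k) ∈ indexed s L) (sym eq) r∈ , trans index≡ (cong (λ z → s + z) (sym (beads-gap bn)))

  lastRow : ℕ → List ℕ → ℕ × ℕ
  lastRow s []       = 0 , 0
  lastRow s (p ∷ ps) = lastOf (s , p) (indexed (suc s) ps)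

  record LastRowSource (s n : ℕ) (rp : ℕ × ℕ) : Set where
    field
      source   : RowSource s n (proj₁ rp) (proj₂ rp)
      gap-pos  : ℕ
      gap-next : RowSource.bead-at source ≡ suc gap-pos
      is-gap   : b gap-pos ≡ false

  private
    gap-before-first-row : ∀ n → gaps n ≢ 0 → rows n ≡ [] → ∃ λ k → n ≡ suc k × b k ≡ false
    gap-before-first-row zero    gn≢0 _ = ⊥-elim (gn≢0 refl)
    gap-before-first-row (suc k) gn≢0 rows≡[] = cases (b k) refl
      where
      cases : ∀ c → b k ≡ c → ∃ λ k′ → suc k ≡ suc k′ × b k′ ≡ false
      cases false bk = k , refl , bk
      cases true  bk with bead-row (suc k) 0 ≤-refl bk (gn≢0 ∘′ trans (gaps-bead bk))
      ... | r , r∈ , _ with subst (λ L → (r , gaps k) ∈ indexed 0 L) rows≡[] r∈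
      ...   | ()

  lastRow-source : ∀ n s → rows n ≢ [] → LastRowSource s n (lastRow s (rows n))
  lastRow-source zero    s rows≢[] = ⊥-elim (rows≢[] refl)
  lastRow-source (suc n) s rows≢[] with rowStep n
  ... | new-row bn gn≢0 eq rewrite eq = go (rows n) refl
    where
    go : ∀ L → rows n ≡ L → LastRowSource s (suc n) (lastRow s (gaps n ∷ L))
    go [] rows≡[] with gap-before-first-row n gn≢0 rows≡[]
    ... | k , refl , bk = record
      { source = record { bead-at = suc k ; bead<n = ≤-refl ; bead = bn ; gaps≡ = refl ; p≢0 = gn≢0 ; index≡ = refl }
      ; gap-pos = k ; gap-next = refl ; is-gap = bk }
    go (q ∷ qs) rows≡q∷qs = record
      { source = extend-bead bn source ; gap-pos = gap-pos ; gap-next = gap-next ; is-gap = is-gap }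
      where open LastRowSource (subst (λ L → LastRowSource (suc s) n (lastRow (suc s) L)) rows≡q∷qs
                                  (lastRow-source n (suc s) (λ rows≡[] → ∷≢[] (trans (sym rows≡q∷qs) rows≡[]))))
  ... | zero-row _ gn≡0 eq rewrite eq =
    ⊥-elim (no-source-below-zero-row gn≡0 (LastRowSource.source (lastRow-source n s rows≢[])))
  ... | gap bn eq rewrite eq = record { source = extend-gap bn source ; gap-pos = gap-pos ; gap-next = gap-next ; is-gap = is-gap }
    where open LastRowSource (lastRow-source n s rows≢[])

  length-rows-zero-bead : ∀ n {k} → k < n → b k ≡ true → gaps k ≡ 0 → length (rows n) + suc k ≤ beads n
  length-rows-zero-bead (suc n) {k} k<1+n bk gk≡0 with m<1+n⇒m<n∨m≡n k<1+n
  ... | inj₂ refl = subst₂ _≤_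
    (sym (cong (λ L → length L + suc k) (trans (rows-suc-zero bk gk≡0) (rows-empty k gk≡0))))
    (sym (trans (beads-bead bk) (cong suc beads≡k))) ≤-refl
    where
    beads≡k : beads k ≡ k
    beads≡k = trans (sym (cong (_+ beads k) gk≡0)) (gaps+beads k)
  ... | inj₁ k<n with rowStep n | length-rows-zero-bead n k<n bk gk≡0
  ...   | new-row bn _ eq | ih = subst₂ _≤_ (sym (cong (λ L → length L + suc k) eq)) (sym (beads-bead bn)) (s≤s ih)
  ...   | zero-row bn _ eq | ih = subst₂ _≤_ (sym (cong (λ L → length L + suc k) eq)) (sym (beads-bead bn)) (m≤n⇒m≤1+n ih)
  ...   | gap bn eq | ih = subst₂ _≤_ (sym (cong (λ L → length L + suc k) eq)) (sym (beads-gap bn)) ih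

  beads≤length-rows-gap : ∀ n {k} → k < n → b k ≡ false → beads n ≤ length (rows n) + k
  beads≤length-rows-gap (suc n) {k} k<1+n bk with m<1+n⇒m<n∨m≡n k<1+n
  ... | inj₂ refl = subst₂ _≤_ (sym (beads-gap bk)) (sym (cong (λ L → length L + k) (rows-suc-gap bk)))
                      (≤-trans (beads≤ k) (m≤n+m k _))
  ... | inj₁ k<n with rowStep n | beads≤length-rows-gap n k<n bk
  ...   | new-row bn _ eq | ih = subst₂ _≤_ (sym (beads-bead bn)) (sym (cong (λ L → length L + k) eq)) (s≤s ih)
  ...   | zero-row _ gn≡0 _ | _ = ⊥-elim (0≢1+n (sym (n≤0⇒n≡0 (≤-trans (≤-trans (≤-reflexive (sym (gaps-gap bk))) (gaps-mono k<n)) (≤-reflexive gn≡0)))))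
  ...   | gap bn eq | ih = subst₂ _≤_ (sym (beads-gap bn)) (sym (cong (λ L → length L + k) eq)) ih

act-++ : ∀ {ℓ} (u v : Word ℓ) (x : Vecℤ ℓ) → act (u ++ v) x ≡ act u (act v x)
act-++ []      v x = refl
act-++ (i ∷ u) v x = cong (gen i) (act-++ u v x)

gen-cong : ∀ {ℓ} (i : Fin ℓ) {x y : Vecℤ ℓ} → (∀ k → x k ≡ y k) → ∀ k → gen i x k ≡ gen i y k
gen-cong {suc m} Fin.zero x≗y k with does (k Fin.≟ Fin.zero) | does (k Fin.≟ fromℕ m)
... | true  | _     = cong (ℤ._+ + 1) (x≗y (fromℕ m))
... | false | true  = cong (ℤ._- + 1) (x≗y Fin.zero)
... | false | false = x≗y k
gen-cong {suc m} (Fin.suc j) x≗y k with does (k Fin.≟ inject₁ j) | does (k Fin.≟ Fin.suc j)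
... | true  | _     = x≗y (Fin.suc j)
... | false | true  = x≗y (inject₁ j)
... | false | false = x≗y k

act-cong : ∀ {ℓ} (u : Word ℓ) {x y : Vecℤ ℓ} → (∀ k → x k ≡ y k) → ∀ k → act u x k ≡ act u y k
act-cong []      x≗y = x≗y
act-cong (i ∷ u) x≗y = gen-cong i (act-cong u x≗y)

module Positions (n : ℕ) where

  open import Data.Integer using (_+_; _-_; _*_; _≤_; _<_)

  m ℓ : ℕ
  m = suc n
  ℓ = suc m

  position : Fin ℓ → ℤ → ℤ
  position j q = + toℕ j + q * + ℓ

  runner : ℤ → Fin ℓ
  runner y = fromℕ< (n%ℕd<d y ℓ)

  private
    below-next-level : ∀ {r} q → r ℕ.< ℓ → + r + q * + ℓ < (q + + 1) * + ℓ
    below-next-level {r} q r<ℓ = subst (+ r + q * + ℓ <_) (eq (+ ℓ) q) (ℤP.+-monoˡ-< (q * + ℓ) (ℤ.+<+ r<ℓ))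
      where eq : ∀ L q → L + q * L ≡ (q + + 1) * L
            eq = solve-∀

    not-below : ∀ {r j q q′} → r ℕ.< ℓ → + r + q′ * + ℓ ≡ + j + q * + ℓ → q′ < q → ⊥
    not-below {r} {j} {q} {q′} r<ℓ eq q′<q = ℤP.<-irrefl eq (ℤP.<-≤-trans (below-next-level q′ r<ℓ) (begin
      (q′ + + 1) * + ℓ   ≤⟨ ℤP.*-monoʳ-≤-nonNeg (+ ℓ) (subst (_≤ q) (ℤP.+-comm (+ 1) q′) (ℤP.i<j⇒suc[i]≤j q′<q)) ⟩
      q * + ℓ            ≤⟨ ℤP.i≤j+i (q * + ℓ) (+ j) ⟩
      + j + q * + ℓ      ∎))
      where open ℤP.≤-Reasoning

    level-unique : ∀ {r j q q′} → r ℕ.< ℓ → j ℕ.< ℓ → + r + q′ * + ℓ ≡ + j + q * + ℓ → q′ ≡ q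
    level-unique {q = q} {q′} r<ℓ j<ℓ eq with ℤP.<-cmp q′ q
    ... | tri< q′<q _ _ = ⊥-elim (not-below r<ℓ eq q′<q)
    ... | tri≈ _ q′≡q _ = q′≡q
    ... | tri> _ _ q<q′ = ⊥-elim (not-below j<ℓ (sym eq) q<q′)

    divmod-position : ∀ j q → ((+ toℕ j + q * + ℓ) /ℕ ℓ ≡ q) × ((+ toℕ j + q * + ℓ) %ℕ ℓ ≡ toℕ j)
    divmod-position j q = level≡ , ℤP.+-injective (∙-cancelʳ (q * + ℓ) _ _ (trans
      (sym (trans (a≡a%ℕn+[a/ℕn]*n y ℓ) (cong (λ z → + (y %ℕ ℓ) + z * + ℓ) level≡))) refl))
      where
      y : ℤ
      y = + toℕ j + q * + ℓ
      level≡ : y /ℕ ℓ ≡ q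
      level≡ = level-unique (n%ℕd<d y ℓ) (FinP.toℕ<n j) (sym (a≡a%ℕn+[a/ℕn]*n y ℓ))

  level-position : ∀ j q → position j q /ℕ ℓ ≡ q
  level-position j q = proj₁ (divmod-position j q)

  residue-position : ∀ j q → position j q %ℕ ℓ ≡ toℕ j
  residue-position j q = proj₂ (divmod-position j q)

  runner-position : ∀ j q → runner (position j q) ≡ j
  runner-position j q = FinP.toℕ-injective (trans (FinP.toℕ-fromℕ< _) (residue-position j q))

  position-runner : ∀ y → y ≡ position (runner y) (y /ℕ ℓ)
  position-runner y = trans (a≡a%ℕn+[a/ℕn]*n y ℓ)
    (cong (λ z → + z + (y /ℕ ℓ) * + ℓ) (sym (FinP.toℕ-fromℕ< (n%ℕd<d y ℓ))))

  position-monoʳ-≤ : ∀ j {q q′} → q ≤ q′ → position j q ≤ position j q′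
  position-monoʳ-≤ j q≤q′ = ℤP.+-monoʳ-≤ (+ toℕ j) (ℤP.*-monoʳ-≤-nonNeg (+ ℓ) q≤q′)

  position-zero≤ : ∀ j q → position Fin.zero q ≤ position j q
  position-zero≤ j q = ℤP.+-monoˡ-≤ (q * + ℓ) (ℤ.+≤+ ℕ.z≤n)

  position<next-level : ∀ j q → position j q < position Fin.zero (q + + 1)
  position<next-level j q = subst (position j q <_) (sym (ℤP.+-identityˡ _)) (below-next-level q (FinP.toℕ<n j))

  level-mono-< : ∀ j j′ {q q′} → position j q < position j′ q′ → q ≤ q′
  level-mono-< j j′ {q} {q′} lt with q ℤ.≤? q′
  ... | yes q≤q′ = q≤q′
  ... | no q≰q′  = ⊥-elim (ℤP.<-asym lt (ℤP.<-≤-trans (position<next-level j′ q′)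
        (ℤP.≤-trans (position-monoʳ-≤ Fin.zero (subst (_≤ q) (ℤP.+-comm (+ 1) q′) (ℤP.i<j⇒suc[i]≤j (ℤP.≰⇒> q≰q′))))
                    (position-zero≤ j q))))

  runner-toℕ : ∀ j → runner (+ toℕ j) ≡ j
  runner-toℕ j = trans (cong runner (sym (trans (cong (λ z → + toℕ j + z) (ℤP.*-zeroˡ (+ ℓ))) (ℤP.+-identityʳ (+ toℕ j)))))
                       (runner-position j (+ 0))

  module _ (a : Vecℤ ℓ) where

    private
      entry : ℕ → ℤ
      entry k = a (runner (+ k))

    minV≤ : ∀ j → minV a ≤ a j
    minV≤ j = subst (λ xs → foldr ℤ._⊓_ (entry 0) xs ≤ a j) (sym (ListP.map-upTo entry ℓ))
      (subst (foldr ℤ._⊓_ (entry 0) (applyUpTo entry ℓ) ≤_) (cong a (runner-toℕ j))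
        (foldr-⊓-applyUpTo-≤ entry (entry 0) (FinP.toℕ<n j)))

    ≤maxV : ∀ j → a j ≤ maxV a
    ≤maxV j = subst (λ xs → a j ≤ foldr ℤ._⊔_ (entry 0) xs) (sym (ListP.map-upTo entry ℓ))
      (subst (_≤ foldr ℤ._⊔_ (entry 0) (applyUpTo entry ℓ)) (cong a (runner-toℕ j))
        (foldr-⊔-applyUpTo-≥ entry (entry 0) (FinP.toℕ<n j)))

module Generators (n : ℕ) where

  open import Data.Integer using (_+_; _-_; -_)

  m ℓ : ℕ
  m = suc n
  ℓ = suc m

  last : Fin ℓ
  last = fromℕ m

  last≢zero : last ≢ Fin.zero
  last≢zero ()

  inject₁≢suc : ∀ (j : Fin m) → inject₁ j ≢ Fin.suc j
  inject₁≢suc j eq = ℕP.1+n≢n (sym (trans (sym (FinP.toℕ-inject₁ j)) (cong toℕ eq)))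

  module _ (a : Vecℤ ℓ) where

    gen-zero-last : gen Fin.zero a last ≡ a Fin.zero - + 1
    gen-zero-last = if-≟-refl last

    gen-zero-other : ∀ {k} → k ≢ last → k ≢ Fin.zero → gen Fin.zero a k ≡ a k
    gen-zero-other k≢last k≢0 = trans (if-≟-≢ k≢0) (if-≟-≢ k≢last)

    module _ (j : Fin m) where

      gen-suc-left : gen (Fin.suc j) a (inject₁ j) ≡ a (Fin.suc j)
      gen-suc-left = if-≟-refl (inject₁ j)

      gen-suc-right : gen (Fin.suc j) a (Fin.suc j) ≡ a (inject₁ j)
      gen-suc-right = trans (if-≟-≢ (inject₁≢suc j ∘ sym)) (if-≟-refl (Fin.suc j))

      gen-suc-other : ∀ {k} → k ≢ inject₁ j → k ≢ Fin.suc j → gen (Fin.suc j) a k ≡ a k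
      gen-suc-other k≢left k≢right = trans (if-≟-≢ k≢left) (if-≟-≢ k≢right)

      gen-suc-transpose : ∀ k → gen (Fin.suc j) a k ≡ a (transpose (inject₁ j) (Fin.suc j) k)
      gen-suc-transpose k = cases k (k Fin.≟ inject₁ j) (k Fin.≟ Fin.suc j)
        where
        cases : ∀ k → Dec (k ≡ inject₁ j) → Dec (k ≡ Fin.suc j) →
                gen (Fin.suc j) a k ≡ a (transpose (inject₁ j) (Fin.suc j) k)
        cases .(inject₁ j) (yes refl) _ =
          trans gen-suc-left (cong a (sym (transpose-matchˡ (inject₁ j) (Fin.suc j))))
        cases .(Fin.suc j) (no _) (yes refl) =
          trans gen-suc-right (cong a (sym (transpose-matchʳ (inject₁≢suc j))))
        cases k (no k≢left) (no k≢right) =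
          trans (gen-suc-other k≢left k≢right) (cong a (sym (transpose-other k≢left k≢right)))

  gen-involutive : ∀ i (b : Vecℤ ℓ) k → gen i (gen i b) k ≡ b k
  gen-involutive (Fin.suc j) b k = begin
    gen (Fin.suc j) (gen (Fin.suc j) b) k ≡⟨ gen-suc-transpose (gen (Fin.suc j) b) j k ⟩
    gen (Fin.suc j) b (τ k)               ≡⟨ gen-suc-transpose b j (τ k) ⟩
    b (τ (τ k))                           ≡⟨ cong b (transpose-involutive (inject₁≢suc j) k) ⟩
    b k                                   ∎
    where
    open ≡-Reasoning
    τ : Fin ℓ → Fin ℓ
    τ = transpose (inject₁ j) (Fin.suc j)
  gen-involutive Fin.zero b k = cases k (k Fin.≟ Fin.zero) (k Fin.≟ last)
    where
    b′ : Vecℤ ℓ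
    b′ = gen Fin.zero b
    x-1+1≡x : ∀ x → x - + 1 + + 1 ≡ x
    x-1+1≡x = solve-∀
    x+1-1≡x : ∀ x → x + + 1 - + 1 ≡ x
    x+1-1≡x = solve-∀
    cases : ∀ k → Dec (k ≡ Fin.zero) → Dec (k ≡ last) → gen Fin.zero b′ k ≡ b k
    cases .Fin.zero (yes refl) _ = trans (cong (_+ + 1) (gen-zero-last b)) (x-1+1≡x (b Fin.zero))
    cases .last (no _) (yes refl) = trans (gen-zero-last b′) (x+1-1≡x (b last))
    cases k (no k≢0) (no k≢last) = trans (gen-zero-other b′ k≢last k≢0) (gen-zero-other b k≢last k≢0)


  InΛR-gen : ∀ i (b : Vecℤ ℓ) → InΛR b → InΛR (gen i b)
  InΛR-gen (Fin.suc j) b b∈Λ = trans (sumℤ-exchange (inject₁≢suc j) (λ u → gen-suc-other b j)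
    (trans (cong₂ _+_ (gen-suc-left b j) (gen-suc-right b j)) (ℤP.+-comm (b (Fin.suc j)) (b (inject₁ j))))) b∈Λ
  InΛR-gen Fin.zero b b∈Λ = trans (sumℤ-exchange last≢zero (λ u u≢last u≢0 → gen-zero-other b u≢last u≢0)
    (trans (cong (_+ (b last + + 1)) (gen-zero-last b)) (swap-unit (b Fin.zero) (b last)))) b∈Λ
    where swap-unit : ∀ x y → x - + 1 + (y + + 1) ≡ y + x
          swap-unit = solve-∀

  -- (0 t+2) = (t+1 t+2) (0 t+1) (t+1 t+2), as permutations of the coordinates
  transpositionWord : ∀ t → t ℕ.< m → Word ℓ
  transpositionWord zero    t<m = [ Fin.suc (fromℕ< t<m) ]
  transpositionWord (suc t) t<m =
    Fin.suc (fromℕ< t<m) ∷ (transpositionWord t (ℕP.<-trans (ℕP.n<1+n t) t<m) ++ [ Fin.suc (fromℕ< t<m) ])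

  transpositionWord-finite : ∀ t t<m → IsFiniteWord (transpositionWord t t<m)
  transpositionWord-finite zero    t<m = (λ ()) All.∷ All.[]
  transpositionWord-finite (suc t) t<m = (λ ()) All.∷ ++⁺ (transpositionWord-finite t _) ((λ ()) All.∷ All.[])

  act-transpositionWord : ∀ t (t<m : t ℕ.< m) (x : Vecℤ ℓ) k →
                          act (transpositionWord t t<m) x k ≡ x (transpose Fin.zero (Fin.suc (fromℕ< t<m)) k)
  act-transpositionWord zero    t<m x k = gen-suc-transpose x (fromℕ< t<m) k
  act-transpositionWord (suc t) t<m x k = begin
    gen s (act (τw ++ [ s ]) x) k         ≡⟨ gen-suc-transpose (act (τw ++ [ s ]) x) j k ⟩
    act (τw ++ [ s ]) x (τ k)              ≡⟨ cong (λ f → f (τ k)) (act-++ τw [ s ] x) ⟩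
    act τw (gen s x) (τ k)                 ≡⟨ act-transpositionWord t t<m′ (gen s x) (τ k) ⟩
    gen s x (transpose Fin.zero B′ (τ k)) ≡⟨ cong (λ B → gen s x (transpose Fin.zero B (τ k))) B′≡B ⟩
    gen s x (transpose Fin.zero B (τ k))  ≡⟨ gen-suc-transpose x j (transpose Fin.zero B (τ k)) ⟩
    x (τ (transpose Fin.zero B (τ k)))    ≡⟨ cong x (transpose-conjugate 0≢B (λ ()) (inject₁≢suc j) k) ⟩
    x (transpose Fin.zero (Fin.suc j) k)  ∎
    where
    open ≡-Reasoning
    t<m′ : t ℕ.< m
    t<m′ = ℕP.<-trans (ℕP.n<1+n t) t<m
    j : Fin m
    j = fromℕ< t<m
    s B B′ : Fin ℓ
    s = Fin.suc j
    B = inject₁ j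
    B′ = Fin.suc (fromℕ< t<m′)
    τw : Word ℓ
    τw = transpositionWord t t<m′
    τ : Fin ℓ → Fin ℓ
    τ = transpose B s
    B≡1+t : toℕ B ≡ suc t
    B≡1+t = trans (FinP.toℕ-inject₁ j) (FinP.toℕ-fromℕ< t<m)
    B′≡B : B′ ≡ B
    B′≡B = FinP.toℕ-injective (trans (cong suc (FinP.toℕ-fromℕ< t<m′)) (sym B≡1+t))
    0≢B : Fin.zero ≢ B
    0≢B eq = ℕP.0≢1+n (trans (cong toℕ eq) B≡1+t)

  linearPart : Fin ℓ → Word ℓ
  linearPart Fin.zero    = transpositionWord n (ℕP.n<1+n n)
  linearPart (Fin.suc j) = [ Fin.suc j ]

  linearPart-finite : ∀ i → IsFiniteWord (linearPart i)
  linearPart-finite Fin.zero    = transpositionWord-finite n (ℕP.n<1+n n)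
  linearPart-finite (Fin.suc j) = (λ ()) All.∷ All.[]

  gen-affine : ∀ i (x y : Vecℤ ℓ) k → gen i (λ k → x k + y k) k ≡ act (linearPart i) x k + gen i y k
  gen-affine (Fin.suc j) x y k = begin
    gen (Fin.suc j) (λ k → x k + y k) k                  ≡⟨ gen-suc-transpose (λ k → x k + y k) j k ⟩
    x (τ k) + y (τ k)                                    ≡⟨ cong₂ _+_ (gen-suc-transpose x j k) (gen-suc-transpose y j k) ⟨
    gen (Fin.suc j) x k + gen (Fin.suc j) y k            ∎
    where
    open ≡-Reasoning
    τ : Fin ℓ → Fin ℓ
    τ = transpose (inject₁ j) (Fin.suc j)
  gen-affine Fin.zero x y k = trans (cases k (k Fin.≟ Fin.zero) (k Fin.≟ last))
    (cong (_+ gen Fin.zero y k) (sym (trans (act-transpositionWord n (ℕP.n<1+n n) x k)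
      (cong (λ B → x (transpose Fin.zero B k)) last≡))))
    where
    last≡ : Fin.suc (fromℕ< (ℕP.n<1+n n)) ≡ last
    last≡ = FinP.toℕ-injective (cong suc (trans (FinP.toℕ-fromℕ< _) (sym (FinP.toℕ-fromℕ n))))
    z : Vecℤ ℓ
    z k = x k + y k
    cases : ∀ k → Dec (k ≡ Fin.zero) → Dec (k ≡ last) →
            gen Fin.zero z k ≡ x (transpose Fin.zero last k) + gen Fin.zero y k
    cases .Fin.zero (yes refl) _ = trans (ℤP.+-assoc (x last) (y last) (+ 1))
      (cong (_+ (y last + + 1)) (cong x (sym (transpose-matchˡ Fin.zero last))))
    cases .last (no _) (yes refl) = trans (gen-zero-last z) (trans (ℤP.+-assoc (x Fin.zero) (y Fin.zero) (- + 1))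
      (cong₂ _+_ (cong x (sym (transpose-matchʳ (last≢zero ∘ sym)))) (sym (gen-zero-last y))))
    cases k (no k≢0) (no k≢last) = trans (gen-zero-other z k≢last k≢0)
      (cong₂ _+_ (cong x (sym (transpose-other k≢0 k≢last))) (sym (gen-zero-other y k≢last k≢0)))

  InCoset-∷ : ∀ i (b : Vecℤ ℓ) w → InCoset (gen i b) w → InCoset b (i ∷ w)
  InCoset-∷ i b w (σ , σ-finite , w≡σ+) = linearPart i ++ σ , ++⁺ (linearPart-finite i) σ-finite , λ x x∈Λ k → begin
    gen i (act w x) k                                 ≡⟨ gen-cong i (w≡σ+ x x∈Λ) k ⟩
    gen i (λ k → act σ x k + gen i b k) k             ≡⟨ gen-affine i (act σ x) (gen i b) k ⟩
    act (linearPart i) (act σ x) k + gen i (gen i b) k ≡⟨ cong₂ _+_ (cong (λ f → f k) (sym (act-++ (linearPart i) σ x))) (gen-involutive i b k) ⟩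
    act (linearPart i ++ σ) x k + b k                 ∎
    where open ≡-Reasoning

  InCoset-[] : ∀ (b : Vecℤ ℓ) → (∀ k → b k ≡ + 0) → InCoset b []
  InCoset-[] b b≡0 = [] , All.[] , λ x _ k → trans (sym (ℤP.+-identityʳ (x k))) (cong (λ c → x k + c) (sym (b≡0 k)))

  InCoset-cong : ∀ {a b : Vecℤ ℓ} {w} → (∀ k → a k ≡ b k) → InCoset b w → InCoset a w
  InCoset-cong a≗b (σ , σ-finite , w≡σ+) = σ , σ-finite , λ x x∈Λ k → trans (w≡σ+ x x∈Λ k) (cong (λ c → act σ x k + c) (sym (a≗b k)))

  finiteWord-fixes-0 : ∀ σ → IsFiniteWord σ → (x : Vecℤ ℓ) → (∀ k → x k ≡ + 0) → ∀ k → act σ x k ≡ + 0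
  finiteWord-fixes-0 []                _                x x≡0 k = x≡0 k
  finiteWord-fixes-0 (Fin.zero ∷ σ)    (0≢0 All.∷ _)    x x≡0 k = ⊥-elim (0≢0 refl)
  finiteWord-fixes-0 (Fin.suc j ∷ σ)   (_ All.∷ σ-finite) x x≡0 k =
    trans (gen-suc-transpose (act σ x) j k) (finiteWord-fixes-0 σ σ-finite x x≡0 _)

module LengthFunction (n : ℕ) where

  open Generators n
  open NatSum
  open import Data.Integer using (_+_; _-_; -_; _≤_; _<_)

  χ≤ : Fin ℓ → Fin ℓ → ℤ
  χ≤ j k = if does (toℕ j ℕ.≤? toℕ k) then + 1 else + 0

  χ≤-yes : ∀ {j k} → toℕ j ℕ.≤ toℕ k → χ≤ j k ≡ + 1
  χ≤-yes {j} {k} j≤k = cong (if_then + 1 else + 0) (dec-true (toℕ j ℕ.≤? toℕ k) j≤k)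

  χ≤-no : ∀ {j k} → ¬ toℕ j ℕ.≤ toℕ k → χ≤ j k ≡ + 0
  χ≤-no {j} {k} j≰k = cong (if_then + 1 else + 0) (dec-false (toℕ j ℕ.≤? toℕ k) j≰k)

  excess : Vecℤ ℓ → Fin ℓ → Fin ℓ → ℕ
  excess a j k = posPart (a j - a k - χ≤ j k)

  cosetLength : Vecℤ ℓ → ℕ
  cosetLength a = ∑[ j < ℓ ] ∑[ k < ℓ ] excess a j k

  excess-diagonal : ∀ a u → excess a u u ≡ 0
  excess-diagonal a u = cong posPart (trans (cong (λ c → a u - a u - c) (χ≤-yes {u} {u} ℕP.≤-refl)) (x-x-1 (a u)))
    where x-x-1 : ∀ x → x - x - + 1 ≡ - + 1
          x-x-1 = solve-∀

  excess-cong : ∀ {a b} → (∀ k → a k ≡ b k) → ∀ u v → excess a u v ≡ excess b u v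
  excess-cong a≗b u v = cong₂ (λ x y → posPart (x - y - χ≤ u v)) (a≗b u) (a≗b v)

  cosetLength-cong : ∀ {a b} → (∀ k → a k ≡ b k) → cosetLength a ≡ cosetLength b
  cosetLength-cong a≗b = sum-cong-≗ (λ u → sum-cong-≗ (excess-cong a≗b u))

  private
    exchange-≤ : ∀ {X′ X P P′} → X′ ℕ.+ P ≡ X ℕ.+ P′ → P′ ℕ.≤ P ℕ.+ 1 → X′ ℕ.≤ X ℕ.+ 1
    exchange-≤ {X′} {X} {P} {P′} eq P′≤P+1 = ℕP.+-cancelʳ-≤ P X′ (X ℕ.+ 1) (begin
      X′ ℕ.+ P         ≡⟨ eq ⟩
      X ℕ.+ P′         ≤⟨ ℕP.+-monoʳ-≤ X P′≤P+1 ⟩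
      X ℕ.+ (P ℕ.+ 1)  ≡⟨ ℕP.+-comm X (P ℕ.+ 1) ⟩
      P ℕ.+ 1 ℕ.+ X    ≡⟨ ℕP.+-assoc P 1 X ⟩
      P ℕ.+ (1 ℕ.+ X)  ≡⟨ ℕP.+-comm P (suc X) ⟩
      suc X ℕ.+ P      ≡⟨ cong (ℕ._+ P) (ℕP.+-comm 1 X) ⟩
      X ℕ.+ 1 ℕ.+ P    ∎)
      where open ℕP.≤-Reasoning

    exchange-≡ : ∀ {X′ X P P′} → X′ ℕ.+ P ≡ X ℕ.+ P′ → P′ ℕ.+ 1 ≡ P → X′ ℕ.+ 1 ≡ X
    exchange-≡ {X′} {X} {P} {P′} eq P′+1≡P = ℕP.+-cancelʳ-≡ P′ _ _ (begin
      X′ ℕ.+ 1 ℕ.+ P′  ≡⟨ ℕP.+-assoc X′ 1 P′ ⟩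
      X′ ℕ.+ suc P′    ≡⟨ cong (λ z → X′ ℕ.+ z) (trans (ℕP.+-comm 1 P′) P′+1≡P) ⟩
      X′ ℕ.+ P         ≡⟨ eq ⟩
      X ℕ.+ P′         ∎)
      where open ≡-Reasoning

  module _ (j : Fin m) (a : Vecℤ ℓ) where

    private
      p q : Fin ℓ
      p = inject₁ j
      q = Fin.suc j
      a′ : Vecℤ ℓ
      a′ = gen q a
      toℕp : toℕ p ≡ toℕ j
      toℕp = FinP.toℕ-inject₁ j

      p≤q : toℕ p ℕ.≤ toℕ q
      p≤q = ℕP.≤-trans (ℕP.≤-reflexive toℕp) (ℕP.n≤1+n (toℕ j))

      ≢toℕ : ∀ {u v : Fin ℓ} → u ≢ v → toℕ u ≢ toℕ v
      ≢toℕ u≢v = u≢v ∘ FinP.toℕ-injective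

      χ≤-col : ∀ u → u ≢ p → u ≢ q → χ≤ u q ≡ χ≤ u p
      χ≤-col u u≢p u≢q with toℕ u ℕ.≤? toℕ p
      ... | yes u≤p = trans (χ≤-yes (ℕP.≤-trans u≤p p≤q)) (sym (χ≤-yes u≤p))
      ... | no u≰p  = trans (χ≤-no u≰q) (sym (χ≤-no u≰p))
        where
        u≰q : ¬ toℕ u ℕ.≤ toℕ q
        u≰q u≤q = u≰p (ℕP.≤-trans (ℕ.s≤s⁻¹ (ℕP.≤∧≢⇒< u≤q (≢toℕ u≢q))) (ℕP.≤-reflexive (sym toℕp)))

      χ≤-row : ∀ v → v ≢ p → v ≢ q → χ≤ p v ≡ χ≤ q v
      χ≤-row v v≢p v≢q with toℕ q ℕ.≤? toℕ v
      ... | yes q≤v = trans (χ≤-yes (ℕP.≤-trans p≤q q≤v)) (sym (χ≤-yes q≤v))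
      ... | no q≰v  = trans (χ≤-no p≰v) (sym (χ≤-no q≰v))
        where
        p≰v : ¬ toℕ p ℕ.≤ toℕ v
        p≰v p≤v = q≰v (subst (ℕ._< toℕ v) toℕp (ℕP.≤∧≢⇒< p≤v (≢toℕ (v≢p ∘ sym))))

      χ≤-pq : χ≤ p q ≡ + 1
      χ≤-pq = χ≤-yes p≤q

      χ≤-qp : χ≤ q p ≡ + 0
      χ≤-qp = χ≤-no (λ q≤p → ℕP.1+n≰n (ℕP.≤-trans q≤p (ℕP.≤-reflexive toℕp)))

      excess-gen-suc : ∀ u v {x y} → a′ u ≡ a x → a′ v ≡ a y → χ≤ u v ≡ χ≤ x y → excess a′ u v ≡ excess a x y
      excess-gen-suc u v eu ev eχ = cong posPart (cong₂ _-_ (cong₂ _-_ eu ev) eχ)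

      d : ℤ
      d = a p - a q

    cosetLength-gen-suc : let d = a (inject₁ j) - a (Fin.suc j) in
                          cosetLength (gen (Fin.suc j) a) ℕ.+ pairExcess d ≡ cosetLength a ℕ.+ pairExcess (- d)
    cosetLength-gen-suc = subst₂ (λ P P′ → cosetLength a′ ℕ.+ P ≡ cosetLength a ℕ.+ P′) pair pair′
      (sum₂-transpose (excess a) (excess a′) (inject₁≢suc j)
        (λ u v u≢p u≢q v≢p v≢q → excess-gen-suc u v (gen-suc-other a j u≢p u≢q) (gen-suc-other a j v≢p v≢q) refl)
        (λ u u≢p u≢q → excess-gen-suc u p (gen-suc-other a j u≢p u≢q) (gen-suc-left a j) (sym (χ≤-col u u≢p u≢q)))
        (λ u u≢p u≢q → excess-gen-suc u q (gen-suc-other a j u≢p u≢q) (gen-suc-right a j) (χ≤-col u u≢p u≢q))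
        (λ v v≢p v≢q → excess-gen-suc p v (gen-suc-left a j) (gen-suc-other a j v≢p v≢q) (χ≤-row v v≢p v≢q))
        (λ v v≢p v≢q → excess-gen-suc q v (gen-suc-right a j) (gen-suc-other a j v≢p v≢q) (sym (χ≤-row v v≢p v≢q)))
        (excess-diagonal a p) (excess-diagonal a q) (excess-diagonal a′ p) (excess-diagonal a′ q))
      where
      pair : excess a p q ℕ.+ excess a q p ≡ pairExcess d
      pair = cong₂ ℕ._+_ (cong (λ c → posPart (d - c)) χ≤-pq)
        (cong posPart (trans (cong (λ c → a q - a p - c) χ≤-qp) (flip (a p) (a q))))
        where flip : ∀ x y → y - x - + 0 ≡ - (x - y)
              flip = solve-∀
      pair′ : excess a′ p q ℕ.+ excess a′ q p ≡ pairExcess (- d)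
      pair′ = cong₂ ℕ._+_
        (cong posPart (trans (cong₂ (λ x c → x - c) (cong₂ _-_ (gen-suc-left a j) (gen-suc-right a j)) χ≤-pq) (flip₁ (a p) (a q))))
        (cong posPart (trans (cong₂ (λ x c → x - c) (cong₂ _-_ (gen-suc-right a j) (gen-suc-left a j)) χ≤-qp) (flip₂ (a p) (a q))))
        where flip₁ : ∀ x y → y - x - + 1 ≡ - (x - y) - + 1
              flip₁ = solve-∀
              flip₂ : ∀ x y → x - y - + 0 ≡ - - (x - y)
              flip₂ = solve-∀

  toℕ-last : toℕ last ≡ m
  toℕ-last = FinP.toℕ-fromℕ m

  χ≤-last : ∀ u → χ≤ u last ≡ + 1
  χ≤-last u = χ≤-yes (subst (toℕ u ℕ.≤_) (sym toℕ-last) (FinP.toℕ≤pred[n] u))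

  χ≤-zero : ∀ v → χ≤ Fin.zero v ≡ + 1
  χ≤-zero v = χ≤-yes {Fin.zero} {v} ℕ.z≤n

  χ≤-to-zero : ∀ {u} → u ≢ Fin.zero → χ≤ u Fin.zero ≡ + 0
  χ≤-to-zero {Fin.zero}  u≢0 = ⊥-elim (u≢0 refl)
  χ≤-to-zero {Fin.suc u} _   = χ≤-no {Fin.suc u} {Fin.zero} (λ ())

  χ≤-from-last : ∀ {v} → v ≢ last → χ≤ last v ≡ + 0
  χ≤-from-last {v} v≢last = χ≤-no (λ last≤v → v≢last (FinP.toℕ-injective (ℕP.≤-antisym
    (subst (toℕ v ℕ.≤_) (sym toℕ-last) (FinP.toℕ≤pred[n] v)) last≤v)))

  module _ (a : Vecℤ ℓ) where

    private
      a′ : Vecℤ ℓ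
      a′ = gen Fin.zero a

      excess-via : ∀ u v {A B c} x y → a′ u ≡ A → a′ v ≡ B → χ≤ u v ≡ c →
                   A - B - c ≡ a x - a y - χ≤ x y → excess a′ u v ≡ excess a x y
      excess-via u v x y eu ev eχ eq = cong posPart (trans (cong₂ _-_ (cong₂ _-_ eu ev) eχ) eq)

      d : ℤ
      d = a Fin.zero - a last

    cosetLength-gen-zero : let d = a Fin.zero - a last in
                           cosetLength (gen Fin.zero a) ℕ.+ pairExcess d ≡ cosetLength a ℕ.+ pairExcess (d - + 1)
    cosetLength-gen-zero = subst₂ (λ P P′ → cosetLength a′ ℕ.+ P ≡ cosetLength a ℕ.+ P′) pair pair′
      (sum₂-transpose (excess a) (excess a′) last≢zero
        (λ u v u≢p u≢q v≢p v≢q → excess-via u v u v (gen-zero-other a u≢p u≢q) (gen-zero-other a v≢p v≢q) refl refl)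
        (λ u u≢p u≢q → excess-via u last u Fin.zero (gen-zero-other a u≢p u≢q) (gen-zero-last a) (χ≤-last u)
          (trans (shift₁ (a u) (a Fin.zero)) (cong (λ c → a u - a Fin.zero - c) (sym (χ≤-to-zero u≢q)))))
        (λ u u≢p u≢q → excess-via u Fin.zero u last (gen-zero-other a u≢p u≢q) refl (χ≤-to-zero u≢q)
          (trans (shift₂ (a u) (a last)) (cong (λ c → a u - a last - c) (sym (χ≤-last u)))))
        (λ v v≢p v≢q → excess-via last v Fin.zero v (gen-zero-last a) (gen-zero-other a v≢p v≢q) (χ≤-from-last v≢p)
          (trans (shift₃ (a Fin.zero) (a v)) (cong (λ c → a Fin.zero - a v - c) (sym (χ≤-zero v)))))
        (λ v v≢p v≢q → excess-via Fin.zero v last v refl (gen-zero-other a v≢p v≢q) (χ≤-zero v)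
          (trans (shift₄ (a last) (a v)) (cong (λ c → a last - a v - c) (sym (χ≤-from-last v≢p)))))
        (excess-diagonal a last) (excess-diagonal a Fin.zero) (excess-diagonal a′ last) (excess-diagonal a′ Fin.zero))
      where
      shift₁ : ∀ x y → x - (y - + 1) - + 1 ≡ x - y - + 0
      shift₁ = solve-∀
      shift₂ : ∀ x y → x - (y + + 1) - + 0 ≡ x - y - + 1
      shift₂ = solve-∀
      shift₃ : ∀ x y → x - + 1 - y - + 0 ≡ x - y - + 1
      shift₃ = solve-∀
      shift₄ : ∀ x y → x + + 1 - y - + 1 ≡ x - y - + 0
      shift₄ = solve-∀
      pair : excess a last Fin.zero ℕ.+ excess a Fin.zero last ≡ pairExcess d
      pair = trans (ℕP.+-comm (excess a last Fin.zero) _) (cong₂ ℕ._+_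
        (cong (λ c → posPart (d - c)) (χ≤-last Fin.zero))
        (cong posPart (trans (cong (λ c → a last - a Fin.zero - c) (χ≤-from-last (last≢zero ∘ sym))) (flip (a Fin.zero) (a last)))))
        where flip : ∀ x y → y - x - + 0 ≡ - (x - y)
              flip = solve-∀
      pair′ : excess a′ last Fin.zero ℕ.+ excess a′ Fin.zero last ≡ pairExcess (d - + 1)
      pair′ = cong₂ ℕ._+_
        (cong posPart (trans (cong₂ (λ x c → x - c) (cong (_- (a last + + 1)) (gen-zero-last a)) (χ≤-from-last (last≢zero ∘ sym)))
          (shift₅ (a Fin.zero) (a last))))
        (cong posPart (trans (cong₂ (λ x c → x - c) (cong (λ y → a last + + 1 - y) (gen-zero-last a)) (χ≤-last Fin.zero))
          (shift₆ (a Fin.zero) (a last))))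
        where shift₅ : ∀ x y → x - + 1 - (y + + 1) - + 0 ≡ x - y - + 1 - + 1
              shift₅ = solve-∀
              shift₆ : ∀ x y → y + + 1 - (x - + 1) - + 1 ≡ - (x - y - + 1)
              shift₆ = solve-∀

  cosetLength-gen-≤ : ∀ i a → cosetLength (gen i a) ℕ.≤ cosetLength a ℕ.+ 1
  cosetLength-gen-≤ Fin.zero    a = exchange-≤ (cosetLength-gen-zero a) (pairExcess-pred-≤ (a Fin.zero - a last))
  cosetLength-gen-≤ (Fin.suc j) a = exchange-≤ (cosetLength-gen-suc j a) (pairExcess-neg-≤ (a (inject₁ j) - a (Fin.suc j)))

  cosetLength-gen-suc-< : ∀ j a → a (inject₁ j) < a (Fin.suc j) →
                          cosetLength (gen (Fin.suc j) a) ℕ.+ 1 ≡ cosetLength a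
  cosetLength-gen-suc-< j a lt = exchange-≡ (cosetLength-gen-suc j a)
    (pairExcess-neg (subst (a (inject₁ j) - a (Fin.suc j) <_) (ℤP.+-inverseʳ (a (Fin.suc j))) (ℤP.+-monoˡ-< (- a (Fin.suc j)) lt)))

  cosetLength-gen-zero-≤ : ∀ a → a last + + 2 ≤ a Fin.zero → cosetLength (gen Fin.zero a) ℕ.+ 1 ≡ cosetLength a
  cosetLength-gen-zero-≤ a le = exchange-≡ (cosetLength-gen-zero a)
    (pairExcess-pred (subst (_≤ a Fin.zero - a last) (cancel (a last)) (ℤP.+-monoˡ-≤ (- a last) le)))
    where cancel : ∀ x → x + + 2 - x ≡ + 2
          cancel = solve-∀

  cosetLength-0 : ∀ a → (∀ k → a k ≡ + 0) → cosetLength a ≡ 0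
  cosetLength-0 a a≡0 = ≡0⇒sum≡0 _ (λ u → ≡0⇒sum≡0 _ (λ v → trans (excess-cong a≡0 u v) (χ-cases u v)))
    where
    χ-cases : ∀ u v → posPart (+ 0 - + 0 - χ≤ u v) ≡ 0
    χ-cases u v with toℕ u ℕ.≤? toℕ v
    ... | yes u≤v = cong (λ c → posPart (+ 0 - + 0 - c)) (χ≤-yes u≤v)
    ... | no u≰v  = cong (λ c → posPart (+ 0 - + 0 - c)) (χ≤-no u≰v)

  cosetLength≡0⇒0 : ∀ a → InΛR a → cosetLength a ≡ 0 → ∀ j → a j ≡ + 0
  cosetLength≡0⇒0 a a∈Λ len≡0 = cases (ℤP.≤-total (+ 0) (a last))
    where
    excess≡0 : ∀ u v → excess a u v ≡ 0
    excess≡0 u v = sum≡0⇒≡0 (excess a u) (sum≡0⇒≡0 (λ u → sum (excess a u)) len≡0 u) v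
    last≤ : ∀ j → a last ≤ a j
    last≤ j with j Fin.≟ last
    ... | yes refl    = ℤP.≤-refl
    ... | no j≢last = ℤP.i-j≤0⇒i≤j (subst (_≤ + 0)
      (trans (cong (λ c → a last - a j - c) (χ≤-from-last j≢last)) (ℤP.+-identityʳ _))
      (posPart≡0⇒nonpos _ (excess≡0 last j)))
    ≤last+1 : ∀ j → a j ≤ a last + + 1
    ≤last+1 j = ℤP.i-j≤0⇒i≤j (subst (_≤ + 0)
      (trans (cong (λ c → a j - a last - c) (χ≤-last j)) (sub-sub (a j) (a last)))
      (posPart≡0⇒nonpos _ (excess≡0 j last)))
      where sub-sub : ∀ x y → x - y - + 1 ≡ x - (y + + 1)
            sub-sub = solve-∀
    cases : + 0 ≤ a last ⊎ a last ≤ + 0 → ∀ j → a j ≡ + 0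
    cases (inj₁ 0≤c) = sumℤ≡0-nonneg a (λ j → ℤP.≤-trans 0≤c (last≤ j)) a∈Λ
    cases (inj₂ c≤0) with a last ℤ.≟ + 0
    ... | yes c≡0 = sumℤ≡0-nonneg a (λ j → subst (_≤ a j) c≡0 (last≤ j)) a∈Λ
    ... | no c≢0  = sumℤ≡0-nonpos a (λ j → ℤP.≤-trans (≤last+1 j) c+1≤0) a∈Λ
      where c+1≤0 : a last + + 1 ≤ + 0
            c+1≤0 = subst (_≤ + 0) (ℤP.+-comm (+ 1) (a last)) (ℤP.i<j⇒suc[i]≤j (ℤP.≤∧≢⇒< c≤0 c≢0))

module Abacus (n : ℕ) where

  open Positions n
  open Generators n using (last)
  open LengthFunction n using (χ≤; χ≤-yes; χ≤-no; excess; cosetLength; cosetLength-gen-suc-<; cosetLength-gen-zero-≤; cosetLength≡0⇒0)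
  open NatSum
  open import Data.Integer using (_+_; _-_; _*_; -_; _≤_; _<_)
  open import Algebra.Properties.CommutativeSemigroup ℕP.+-commutativeSemigroup using (x∙yz≈xz∙y)

  -- the number of gaps on runner j that come before position y
  gapsOnRunner : Vecℤ ℓ → ℤ → Fin ℓ → ℕ
  gapsOnRunner a y j = posPart (y /ℕ ℓ - a j - χ≤ (runner y) j)

  gapsBefore : Vecℤ ℓ → ℤ → ℕ
  gapsBefore a y = sum (gapsOnRunner a y)

  gapsOnRunner-position : ∀ a r Q j → gapsOnRunner a (position r Q) j ≡ posPart (Q - a j - χ≤ r j)
  gapsOnRunner-position a r Q j = cong₂ (λ u v → posPart (u - a j - χ≤ v j)) (level-position r Q) (runner-position r Q)

  module _ (a : Vecℤ ℓ) (r : Fin ℓ) (Q : ℤ) where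

    private
      next-on-level : ∀ (r<m : toℕ r ℕ.< m) → position r Q + + 1 ≡ position (fromℕ< (ℕ.s≤s r<m)) Q
      next-on-level r<m = trans (shift (+ toℕ r) (Q * + ℓ))
        (cong (λ t → + t + Q * + ℓ) (sym (FinP.toℕ-fromℕ< (ℕ.s≤s r<m))))
        where shift : ∀ t X → t + X + + 1 ≡ (+ 1 + t) + X
              shift = solve-∀

      next-level : toℕ r ≡ m → position r Q + + 1 ≡ position Fin.zero (Q + + 1)
      next-level r≡m = trans (cong (λ t → + t + Q * + ℓ + + 1) r≡m) (wrap (+ m) Q)
        where wrap : ∀ M Q → M + Q * (+ 1 + M) + + 1 ≡ + 0 + (Q + + 1) * (+ 1 + M)
              wrap = solve-∀

    gapsOnRunner-suc-other : ∀ j → j ≢ r → gapsOnRunner a (position r Q + + 1) j ≡ gapsOnRunner a (position r Q) j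
    gapsOnRunner-suc-other j j≢r with ℕP.m≤n⇒m<n∨m≡n (FinP.toℕ≤pred[n] r)
    ... | inj₁ r<m = begin
      gapsOnRunner a (position r Q + + 1) j          ≡⟨ cong (λ z → gapsOnRunner a z j) (next-on-level r<m) ⟩
      gapsOnRunner a (position r′ Q) j    ≡⟨ gapsOnRunner-position a r′ Q j ⟩
      posPart (Q - a j - χ≤ r′ j)         ≡⟨ cong (λ c → posPart (Q - a j - c)) χ≡ ⟩
      posPart (Q - a j - χ≤ r j)          ≡⟨ gapsOnRunner-position a r Q j ⟨
      gapsOnRunner a (position r Q) j                  ∎
      where
      open ≡-Reasoning
      r′ : Fin ℓ
      r′ = fromℕ< (ℕ.s≤s r<m)
      r′≡ : toℕ r′ ≡ suc (toℕ r)
      r′≡ = FinP.toℕ-fromℕ< (ℕ.s≤s r<m)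
      χ≡ : χ≤ r′ j ≡ χ≤ r j
      χ≡ with toℕ r ℕ.≤? toℕ j
      ... | yes r≤j = trans (χ≤-yes (subst (ℕ._≤ toℕ j) (sym r′≡) (ℕP.≤∧≢⇒< r≤j (j≢r ∘ FinP.toℕ-injective ∘ sym)))) (sym (χ≤-yes r≤j))
      ... | no r≰j  = trans (χ≤-no (λ r′≤j → r≰j (ℕP.≤-trans (ℕP.n≤1+n _) (subst (ℕ._≤ toℕ j) r′≡ r′≤j)))) (sym (χ≤-no r≰j))
    ... | inj₂ r≡m = begin
      gapsOnRunner a (position r Q + + 1) j                       ≡⟨ cong (λ z → gapsOnRunner a z j) (next-level r≡m) ⟩
      gapsOnRunner a (position Fin.zero (Q + + 1)) j   ≡⟨ gapsOnRunner-position a Fin.zero (Q + + 1) j ⟩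
      posPart (Q + + 1 - a j - χ≤ Fin.zero j)          ≡⟨ cong (λ c → posPart (Q + + 1 - a j - c)) (χ≤-yes {Fin.zero} {j} ℕ.z≤n) ⟩
      posPart (Q + + 1 - a j - + 1)                    ≡⟨ cong posPart (unshift Q (a j)) ⟩
      posPart (Q - a j - + 0)                          ≡⟨ cong (λ c → posPart (Q - a j - c)) (sym χ≡0) ⟩
      posPart (Q - a j - χ≤ r j)                       ≡⟨ gapsOnRunner-position a r Q j ⟨
      gapsOnRunner a (position r Q) j                               ∎
      where
      open ≡-Reasoning
      unshift : ∀ Q x → Q + + 1 - x - + 1 ≡ Q - x - + 0
      unshift = solve-∀
      χ≡0 : χ≤ r j ≡ + 0
      χ≡0 = χ≤-no (λ r≤j → j≢r (FinP.toℕ-injective (ℕP.≤-antisym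
        (ℕP.≤-trans (FinP.toℕ≤pred[n] j) (ℕP.≤-reflexive (sym r≡m))) r≤j)))

    gapsOnRunner-suc-same : gapsOnRunner a (position r Q + + 1) r ≡ posPart (Q - a r)
    gapsOnRunner-suc-same with ℕP.m≤n⇒m<n∨m≡n (FinP.toℕ≤pred[n] r)
    ... | inj₁ r<m = begin
      gapsOnRunner a (position r Q + + 1) r          ≡⟨ cong (λ z → gapsOnRunner a z r) (next-on-level r<m) ⟩
      gapsOnRunner a (position r′ Q) r    ≡⟨ gapsOnRunner-position a r′ Q r ⟩
      posPart (Q - a r - χ≤ r′ r)         ≡⟨ cong (λ c → posPart (Q - a r - c)) (χ≤-no r′≰r) ⟩
      posPart (Q - a r - + 0)             ≡⟨ cong posPart (ℤP.+-identityʳ (Q - a r)) ⟩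
      posPart (Q - a r)                   ∎
      where
      open ≡-Reasoning
      r′ : Fin ℓ
      r′ = fromℕ< (ℕ.s≤s r<m)
      r′≰r : ¬ toℕ r′ ℕ.≤ toℕ r
      r′≰r r′≤r = ℕP.1+n≰n (subst (ℕ._≤ toℕ r) (FinP.toℕ-fromℕ< (ℕ.s≤s r<m)) r′≤r)
    ... | inj₂ r≡m = begin
      gapsOnRunner a (position r Q + + 1) r                       ≡⟨ cong (λ z → gapsOnRunner a z r) (next-level r≡m) ⟩
      gapsOnRunner a (position Fin.zero (Q + + 1)) r   ≡⟨ gapsOnRunner-position a Fin.zero (Q + + 1) r ⟩
      posPart (Q + + 1 - a r - χ≤ Fin.zero r)          ≡⟨ cong (λ c → posPart (Q + + 1 - a r - c)) (χ≤-yes {Fin.zero} {r} ℕ.z≤n) ⟩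
      posPart (Q + + 1 - a r - + 1)                    ≡⟨ cong posPart (unshift Q (a r)) ⟩
      posPart (Q - a r)                                ∎
      where
      open ≡-Reasoning
      unshift : ∀ Q x → Q + + 1 - x - + 1 ≡ Q - x
      unshift = solve-∀

    gapsOnRunner-same : gapsOnRunner a (position r Q) r ≡ posPart (Q - a r - + 1)
    gapsOnRunner-same = trans (gapsOnRunner-position a r Q r) (cong (λ c → posPart (Q - a r - c)) (χ≤-yes {r} {r} ℕP.≤-refl))

  gapsBefore-suc : ∀ a y → gapsBefore a (y + + 1) ≡ gapsBefore a y ℕ.+ (if inX a y then 0 else 1)
  gapsBefore-suc a y = ℕP.+-cancelʳ-≡ (gapsOnRunner a y r) _ _ (begin
    gapsBefore a (y + + 1) ℕ.+ gapsOnRunner a y r         ≡⟨ sum-updateAt r {gapsOnRunner a (y + + 1)} {gapsOnRunner a y} (λ j j≢r → at-y {λ z → gapsOnRunner a (z + + 1) j ≡ gapsOnRunner a z j} (gapsOnRunner-suc-other a r Q j j≢r)) ⟩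
    gapsBefore a y ℕ.+ gapsOnRunner a (y + + 1) r         ≡⟨ cong (λ z → gapsBefore a y ℕ.+ z) on-runner ⟩
    gapsBefore a y ℕ.+ (gapsOnRunner a y r ℕ.+ δ)         ≡⟨ x∙yz≈xz∙y (gapsBefore a y) _ δ ⟩
    gapsBefore a y ℕ.+ δ ℕ.+ gapsOnRunner a y r           ∎)
    where
    open ≡-Reasoning
    r : Fin ℓ
    r = runner y
    Q : ℤ
    Q = y /ℕ ℓ
    δ : ℕ
    δ = if inX a y then 0 else 1
    y≡ : y ≡ position r Q
    y≡ = position-runner y
    at-y : ∀ {P : ℤ → Set} → P (position r Q) → P y
    at-y {P} = subst P (sym y≡)
    on-runner : gapsOnRunner a (y + + 1) r ≡ gapsOnRunner a y r ℕ.+ δ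
    on-runner = begin
      gapsOnRunner a (y + + 1) r                       ≡⟨ at-y {λ z → gapsOnRunner a (z + + 1) r ≡ posPart (Q - a r)} (gapsOnRunner-suc-same a r Q) ⟩
      posPart (Q - a r)                                ≡⟨ posPart-pred Q (a r) ⟩
      posPart (Q - a r - + 1) ℕ.+ δ                    ≡⟨ cong (ℕ._+ δ) (at-y {λ z → gapsOnRunner a z r ≡ posPart (Q - a r - + 1)} (gapsOnRunner-same a r Q)) ⟨
      gapsOnRunner a y r ℕ.+ δ                         ∎

  module _ (a : Vecℤ ℓ) where

    isBead : ℕ → Bool
    isBead k = inX a (pos a k)

    open BeadSequence isBead public

    size : ℕ
    size = ∣ hi a - lo a ∣

    lo≡position : lo a ≡ position Fin.zero (minV a)
    lo≡position = swap (+ ℓ) (minV a)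
      where swap : ∀ L x → L * x ≡ + 0 + x * L
            swap = solve-∀

    hi≡position : hi a ≡ position Fin.zero (maxV a + + 1)
    hi≡position = swap (+ ℓ) (maxV a)
      where swap : ∀ L x → L * (x + + 1) ≡ + 0 + (x + + 1) * L
            swap = solve-∀

    gapsBefore-lo : gapsBefore a (lo a) ≡ 0
    gapsBefore-lo = ≡0⇒sum≡0 _ (λ j → begin
      gapsOnRunner a (lo a) j                              ≡⟨ cong (λ z → gapsOnRunner a z j) lo≡position ⟩
      gapsOnRunner a (position Fin.zero (minV a)) j        ≡⟨ gapsOnRunner-position a Fin.zero (minV a) j ⟩
      posPart (minV a - a j - χ≤ Fin.zero j)               ≡⟨ cong (λ c → posPart (minV a - a j - c)) (χ≤-yes {Fin.zero} {j} ℕ.z≤n) ⟩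
      posPart (minV a - a j - + 1)                         ≡⟨ posPart-nonpos (ℤP.<⇒≤ (below j)) ⟩
      0                                                    ∎)
      where
      open ≡-Reasoning
      below : ∀ j → minV a - a j - + 1 < + 0
      below j = ℤP.≤-<-trans (ℤP.+-monoˡ-≤ (- + 1) (ℤP.i≤j⇒i-j≤0 (minV≤ a j))) (ℤ.-<+ {0} {0})

    gaps≡gapsBefore : ∀ k → gaps k ≡ gapsBefore a (pos a k)
    gaps≡gapsBefore zero    = sym (trans (cong (gapsBefore a) (ℤP.+-identityʳ (lo a))) gapsBefore-lo)
    gaps≡gapsBefore (suc k) = begin
      gaps (suc k)                                               ≡⟨ count-step ⟩
      gaps k ℕ.+ (if isBead k then 0 else 1)                     ≡⟨ cong (ℕ._+ (if isBead k then 0 else 1)) (gaps≡gapsBefore k) ⟩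
      gapsBefore a (pos a k) ℕ.+ (if isBead k then 0 else 1)     ≡⟨ gapsBefore-suc a (pos a k) ⟨
      gapsBefore a (pos a k + + 1)                               ≡⟨ cong (gapsBefore a) (trans (ℤP.+-assoc (lo a) (+ k) (+ 1)) (cong (λ t → lo a + + t) (ℕP.+-comm k 1))) ⟩
      gapsBefore a (pos a (suc k))                               ∎
      where
      open ≡-Reasoning
      count-step : gaps (suc k) ≡ gaps k ℕ.+ (if isBead k then 0 else 1)
      count-step with isBead k in bk
      ... | true  = trans (gaps-bead bk) (sym (ℕP.+-identityʳ _))
      ... | false = trans (gaps-gap bk) (ℕP.+-comm 1 _)

    π≡rows : π a ≡ rows size
    π≡rows = cong (λ ks → filterᵇ nonzero (map gaps (filterᵇ isBead ks))) (ListP.reverse-upTo size)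

    lo≤hi : lo a ≤ hi a
    lo≤hi = ℤP.*-monoˡ-≤-nonNeg (+ ℓ) (ℤP.≤-trans (minV≤ a Fin.zero) (ℤP.≤-trans (≤maxV a Fin.zero) (ℤP.i≤i+j (maxV a) (+ 1))))

    +size : + size ≡ hi a - lo a
    +size = ℤP.0≤i⇒+∣i∣≡i (ℤP.i≤j⇒0≤j-i lo≤hi)

    pos-size : pos a size ≡ hi a
    pos-size = trans (cong (λ z → lo a + z) +size) (cancel (lo a) (hi a))
      where cancel : ∀ x y → x + (y - x) ≡ y
            cancel = solve-∀

    gaps-size : + gaps size ≡ + ℓ * maxV a - sumℤ a
    gaps-size = begin
      + gaps size                             ≡⟨ cong +_ (trans (gaps≡gapsBefore size) (cong (gapsBefore a) pos-size)) ⟩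
      + gapsBefore a (hi a)                   ≡⟨ sumℤ-+ (gapsOnRunner a (hi a)) ⟨
      sumℤ (λ j → + gapsOnRunner a (hi a) j)  ≡⟨ sumℤ-cong on-runner ⟩
      sumℤ (λ j → maxV a - a j)               ≡⟨ sumℤ-const-minus (maxV a) a ⟩
      + ℓ * maxV a - sumℤ a                   ∎
      where
      open ≡-Reasoning
      unshift : ∀ x y → x + + 1 - y - + 1 ≡ x - y
      unshift = solve-∀
      on-runner : ∀ j → + gapsOnRunner a (hi a) j ≡ maxV a - a j
      on-runner j = begin
        + gapsOnRunner a (hi a) j                               ≡⟨ cong (λ z → + gapsOnRunner a z j) hi≡position ⟩
        + gapsOnRunner a (position Fin.zero (maxV a + + 1)) j   ≡⟨ cong +_ (gapsOnRunner-position a Fin.zero (maxV a + + 1) j) ⟩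
        + posPart (maxV a + + 1 - a j - χ≤ Fin.zero j)          ≡⟨ cong (λ c → + posPart (maxV a + + 1 - a j - c)) (χ≤-yes {Fin.zero} {j} ℕ.z≤n) ⟩
        + posPart (maxV a + + 1 - a j - + 1)                    ≡⟨ cong (+_ ∘ posPart) (unshift (maxV a) (a j)) ⟩
        + posPart (maxV a - a j)                                ≡⟨ posPart-nonneg (ℤP.i≤j⇒0≤j-i (≤maxV a j)) ⟩
        maxV a - a j                                            ∎

    beads-size : InΛR a → lo a + + beads size ≡ + ℓ
    beads-size a∈Λ = begin
      lo a + + beads size                           ≡⟨ cong (λ z → lo a + z) beads≡ ⟩
      lo a + (+ size - + gaps size)                 ≡⟨ cong₂ (λ u v → lo a + (u - v)) +size (trans gaps-size (cong (λ s → + ℓ * maxV a - s) a∈Λ)) ⟩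
      lo a + (hi a - lo a - (+ ℓ * maxV a - + 0))   ≡⟨ collapse (+ ℓ) (maxV a) (minV a) ⟩
      + ℓ                                           ∎
      where
      open ≡-Reasoning
      beads≡ : + beads size ≡ + size - + gaps size
      beads≡ = trans (add-sub (+ beads size) (+ gaps size))
        (cong (_- + gaps size) (trans (sym (ℤP.pos-+ (gaps size) (beads size))) (cong +_ (gaps+beads size))))
        where add-sub : ∀ x y → x ≡ y + x - y
              add-sub = solve-∀
      collapse : ∀ L x y → L * y + (L * (x + + 1) - L * y - (L * x - + 0)) ≡ L
      collapse = solve-∀

  private
    -- indexedRows is defined through a local helper that cannot be named; unification solves indexedRowsFrom to it
    mutual
      indexedRowsFrom : List ℕ → ℕ → List ℕ → List (ℕ × ℕ)
      indexedRowsFrom = _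

      unfold-indexedRows : ∀ p ps → indexedRows {ℓ} (p ∷ ps) ≡ (1 , p) ∷ indexedRowsFrom (p ∷ ps) 2 ps
      unfold-indexedRows p ps with p ∷ ps | 2
      ... | _ | _ = refl

    indexedRowsFrom≡indexed : ∀ λ′ r ps → indexedRowsFrom λ′ r ps ≡ indexed r ps
    indexedRowsFrom≡indexed λ′ r []       = refl
    indexedRowsFrom≡indexed λ′ r (q ∷ qs) = cong ((r , q) ∷_) (indexedRowsFrom≡indexed λ′ (suc r) qs)

  indexedRows≡indexed : ∀ λ′ → indexedRows {ℓ} λ′ ≡ indexed 1 λ′
  indexedRows≡indexed []       = refl
  indexedRows≡indexed (p ∷ ps) = trans (unfold-indexedRows p ps) (cong ((1 , p) ∷_) (indexedRowsFrom≡indexed (p ∷ ps) 2 ps))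

  residue-minus-ℓ : ∀ y → (y - + ℓ) %ℕ ℓ ≡ toℕ (runner y)
  residue-minus-ℓ y = trans (cong (_%ℕ ℓ) (trans (cong (_- + ℓ) (position-runner y)) (down (+ toℕ (runner y)) (y /ℕ ℓ) (+ ℓ))))
    (residue-position (runner y) (y /ℕ ℓ - + 1))
    where down : ∀ t q L → t + q * L - L ≡ t + (q - + 1) * L
          down = solve-∀

  inX-bead : ∀ a y → inX a y ≡ true → y /ℕ ℓ ≤ a (runner y)
  inX-bead a y e with (y /ℕ ℓ) ℤ.≤? a (runner y)
  ... | yes le = le

  inX-gap : ∀ a y → inX a y ≡ false → ¬ y /ℕ ℓ ≤ a (runner y)
  inX-gap a y e with (y /ℕ ℓ) ℤ.≤? a (runner y)
  ... | no nle = nle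

  bead-inX : ∀ a y → y /ℕ ℓ ≤ a (runner y) → inX a y ≡ true
  bead-inX a y le = dec-true ((y /ℕ ℓ) ℤ.≤? a (runner y)) le

  module _ (a : Vecℤ ℓ) (a∈Λ : InΛR a) where

    -- box (r, p) has content p − r, and the bead it comes from sits ℓ further along the sequence
    row-end : ∀ {k r p} → isBead a k ≡ true → gaps a k ≡ p → r ℕ.+ beads a (suc k) ≡ 1 ℕ.+ beads a (size a) →
              + p - + r ≡ pos a k - + ℓ
    row-end {k} {r} {p} bk gk≡p index≡ = begin
      + p - + r                                               ≡⟨ cong (λ z → + z - + r) (sym gk≡p) ⟩
      + gaps a k - + r                                        ≡⟨ shift (lo a) (+ gaps a k) (+ r) (+ beads a k) ⟩
      (lo a + (+ gaps a k + + beads a k)) - (lo a + (+ r + + beads a k))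
        ≡⟨ cong₂ (λ u v → (lo a + u) - v) k≡ (trans (cong (λ z → lo a + z) beads≡) (beads-size a a∈Λ)) ⟩
      pos a k - + ℓ                                           ∎
      where
      open ≡-Reasoning
      shift : ∀ l g r b → g - r ≡ (l + (g + b)) - (l + (r + b))
      shift = solve-∀
      k≡ : + gaps a k + + beads a k ≡ + k
      k≡ = trans (sym (ℤP.pos-+ (gaps a k) (beads a k))) (cong +_ (gaps+beads a k))
      beads≡ : + r + + beads a k ≡ + beads a (size a)
      beads≡ = trans (sym (ℤP.pos-+ r (beads a k))) (cong +_ (ℕP.suc-injective
        (trans (sym (ℕP.+-suc r (beads a k))) (trans (cong (λ z → r ℕ.+ z) (sym (beads-bead a bk))) index≡))))

    rowRes-bead : ∀ {k r p} → isBead a k ≡ true → gaps a k ≡ p → r ℕ.+ beads a (suc k) ≡ 1 ℕ.+ beads a (size a) →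
                  rowRes {ℓ} (r , p) ≡ toℕ (runner (pos a k))
    rowRes-bead {k} bk gk≡p index≡ = trans (cong (_%ℕ ℓ) (row-end bk gk≡p index≡)) (residue-minus-ℓ (pos a k))

  module _ (a : Vecℤ ℓ) where

    topBead : Fin ℓ → ℤ
    topBead j = position j (a j)

    lo≤topBead : ∀ j → lo a ≤ topBead j
    lo≤topBead j = subst (_≤ topBead j) (sym (lo≡position a))
      (ℤP.≤-trans (position-monoʳ-≤ Fin.zero (minV≤ a j)) (position-zero≤ j (a j)))

    topBead<hi : ∀ j → topBead j < hi a
    topBead<hi j = subst (topBead j <_) (sym (hi≡position a))
      (ℤP.<-≤-trans (position<next-level j (a j)) (position-monoʳ-≤ Fin.zero (ℤP.+-monoˡ-≤ (+ 1) (≤maxV a j))))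

    topIndex : Fin ℓ → ℕ
    topIndex j = ∣ topBead j - lo a ∣

    pos-topIndex : ∀ j → pos a (topIndex j) ≡ topBead j
    pos-topIndex j = trans (cong (λ z → lo a + z) (ℤP.0≤i⇒+∣i∣≡i (ℤP.i≤j⇒0≤j-i (lo≤topBead j)))) (cancel (lo a) (topBead j))
      where cancel : ∀ u v → u + (v - u) ≡ v
            cancel = solve-∀

    topIndex<size : ∀ j → topIndex j ℕ.< size a
    topIndex<size j = ℤP.drop‿+<+ (subst₂ _<_ (sym (ℤP.0≤i⇒+∣i∣≡i (ℤP.i≤j⇒0≤j-i (lo≤topBead j)))) (sym (+size a))
      (ℤP.+-monoˡ-< (- lo a) (topBead<hi j)))

    isBead-topIndex : ∀ j → isBead a (topIndex j) ≡ true
    isBead-topIndex j = subst (λ z → inX a z ≡ true) (sym (pos-topIndex j))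
      (bead-inX a (topBead j) (subst₂ _≤_ (sym (level-position j (a j))) (cong a (sym (runner-position j (a j)))) ℤP.≤-refl))

    runner-topIndex : ∀ j → runner (pos a (topIndex j)) ≡ j
    runner-topIndex j = trans (cong runner (pos-topIndex j)) (runner-position j (a j))

    pos-cancel-≤ : ∀ {k k′} → pos a k ≤ pos a k′ → k ℕ.≤ k′
    pos-cancel-≤ {k} {k′} le = ℤP.drop‿+≤+ (subst₂ _≤_ (cancel (lo a) (+ k)) (cancel (lo a) (+ k′)) (ℤP.+-monoʳ-≤ (- lo a) le))
      where cancel : ∀ l x → - l + (l + x) ≡ x
            cancel = solve-∀

    bead≤topIndex : ∀ {k j} → isBead a k ≡ true → runner (pos a k) ≡ j → k ℕ.≤ topIndex j
    bead≤topIndex {k} {j} bk rj = pos-cancel-≤ (begin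
      pos a k                       ≡⟨ position-runner (pos a k) ⟩
      position (runner y) (y /ℕ ℓ)  ≡⟨ cong (λ r → position r (y /ℕ ℓ)) rj ⟩
      position j (y /ℕ ℓ)           ≤⟨ position-monoʳ-≤ j (subst (λ r → y /ℕ ℓ ≤ a r) rj (inX-bead a y bk)) ⟩
      topBead j                     ≡⟨ pos-topIndex j ⟨
      pos a (topIndex j)            ∎)
      where
      open ℤP.≤-Reasoning
      y : ℤ
      y = pos a k

  inX-position-bead : ∀ a {j q} → inX a (position j q) ≡ true → q ≤ a j
  inX-position-bead a {j} {q} e = subst₂ (λ u v → u ≤ a v) (level-position j q) (runner-position j q) (inX-bead a (position j q) e)

  inX-position-gap : ∀ a {j q} → inX a (position j q) ≡ false → a j < q
  inX-position-gap a {j} {q} e = ℤP.≰⇒> (λ aj≤q → inX-gap a (position j q) e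
    (subst₂ (λ u v → u ≤ a v) (sym (level-position j q)) (sym (runner-position j q)) aj≤q))

  sum-upTo : ∀ N (f : ℕ → ℕ) → Data.Nat.ListAction.sum (map f (upTo N)) ≡ sum (λ (j : Fin N) → f (toℕ j))
  sum-upTo N f = trans (cong Data.Nat.ListAction.sum (ListP.map-upTo f N)) (go N f)
    where
    go : ∀ N (f : ℕ → ℕ) → Data.Nat.ListAction.sum (applyUpTo f N) ≡ sum (λ (j : Fin N) → f (toℕ j))
    go zero    f = refl
    go (suc N) f = cong (λ z → f 0 ℕ.+ z) (go N (f ∘ suc))

  module _ (a : Vecℤ ℓ) (a∈Λ : InΛR a) where

    private
      ≟-true : ∀ {u v : ℕ} → does (u ℕ.≟ v) ≡ true → u ≡ v
      ≟-true {u} {v} e = ℕP.≡ᵇ⇒≡ u v (subst T (sym e) _)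

    indexedRows-π : indexedRows {ℓ} (π a) ≡ indexed 1 (rows a (size a))
    indexedRows-π = trans (cong (indexedRows {ℓ}) (π≡rows a)) (indexedRows≡indexed _)

    longestWithRes-π : ∀ j → longestWithRes {ℓ} (π a) (toℕ j) ≡ gaps a (topIndex a j)
    longestWithRes-π j = ℕP.≤-antisym longest≤ ≤longest
      where
      hasRes : ℕ × ℕ → Bool
      hasRes rp = does (rowRes {ℓ} rp ℕ.≟ toℕ j)
      longest≤ : longestWithRes {ℓ} (π a) (toℕ j) ℕ.≤ gaps a (topIndex a j)
      longest≤ = foldr-⊔-filterᵇ-≤ proj₂ hasRes (indexedRows {ℓ} (π a)) λ where
        (r , p) r,p∈ res≡j → let open RowSource a (rows-source a (size a) 1 (subst ((r , p) ∈_) indexedRows-π r,p∈)) in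
          ℕP.≤-trans (ℕP.≤-reflexive (sym gaps≡))
            (gaps-mono a (bead≤topIndex a bead (FinP.toℕ-injective (trans (sym (rowRes-bead a a∈Λ bead gaps≡ index≡)) (≟-true res≡j)))))
      ≤longest : gaps a (topIndex a j) ℕ.≤ longestWithRes {ℓ} (π a) (toℕ j)
      ≤longest with gaps a (topIndex a j) ℕ.≟ 0
      ... | yes g≡0 = ℕP.≤-trans (ℕP.≤-reflexive g≡0) ℕ.z≤n
      ... | no g≢0 with bead-row a (size a) 1 (topIndex<size a j) (isBead-topIndex a j) g≢0
      ...   | r , r∈ , index≡ = ≤-foldr-⊔-filterᵇ proj₂ hasRes (indexedRows {ℓ} (π a)) (subst ((r , gaps a (topIndex a j)) ∈_) (sym indexedRows-π) r∈)
        (dec-true (rowRes {ℓ} (r , gaps a (topIndex a j)) ℕ.≟ toℕ j) (trans (rowRes-bead a a∈Λ (isBead-topIndex a j) refl index≡) (cong toℕ (runner-topIndex a j))))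

    resSum-π : resSum {ℓ} (π a) ≡ cosetLength a
    resSum-π = begin
      resSum {ℓ} (π a)                                    ≡⟨ sum-upTo ℓ (longestWithRes {ℓ} (π a)) ⟩
      ∑[ j < ℓ ] longestWithRes {ℓ} (π a) (toℕ j)         ≡⟨ sum-cong-≗ (λ j → trans (longestWithRes-π j) (gaps≡gapsBefore a (topIndex a j))) ⟩
      ∑[ j < ℓ ] gapsBefore a (pos a (topIndex a j))      ≡⟨ sum-cong-≗ (λ j → cong (gapsBefore a) (pos-topIndex a j)) ⟩
      ∑[ j < ℓ ] gapsBefore a (topBead a j)               ≡⟨ sum-cong-≗ (λ j → sum-cong-≗ (gapsOnRunner-position a j (a j))) ⟩
      cosetLength a                                       ∎
      where open ≡-Reasoning

    lastRes-π : ∀ {L} → rows a (size a) ≡ L → L ≢ [] → lastRes {ℓ} (π a) ≡ rowRes {ℓ} (lastRow a 1 L)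
    lastRes-π {[]}     _     L≢[] = ⊥-elim (L≢[] refl)
    lastRes-π {q ∷ qs} rows≡ _    = trans
      (cong (λ rs → foldr (λ rp _ → rowRes {ℓ} rp) 0 (reverse rs)) (trans indexedRows-π (cong (indexed 1) rows≡)))
      (foldr-const-reverse (rowRes {ℓ}) (1 , q) (indexed 2 qs) 0)

    descent : ∀ i → π a ≢ [] → toℕ i ≡ lastRes {ℓ} (π a) → cosetLength (gen i a) ℕ.+ 1 ≡ cosetLength a
    descent i π≢[] i≡res = step i (FinP.toℕ-injective (trans res≡ (sym i≡res)))
      where
      rows≢[] : rows a (size a) ≢ []
      rows≢[] = π≢[] ∘ trans (π≡rows a)
      open LastRowSource a (lastRow-source a (size a) 1 rows≢[])
      open RowSource a source
      res≡ : toℕ (runner (pos a bead-at)) ≡ lastRes {ℓ} (π a)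
      res≡ = trans (sym (rowRes-bead a a∈Λ bead gaps≡ index≡)) (sym (lastRes-π refl rows≢[]))
      y Q : ℤ
      y = pos a bead-at
      Q = y /ℕ ℓ
      y≡ : y ≡ position (runner y) Q
      y≡ = position-runner y
      gap≡ : pos a gap-pos ≡ y - + 1
      gap≡ = trans (back (lo a) (+ gap-pos)) (cong (λ k → lo a + + k - + 1) (sym gap-next))
        where back : ∀ l k → l + k ≡ l + (+ 1 + k) - + 1
              back = solve-∀
      Q≤ : Q ≤ a (runner y)
      Q≤ = inX-bead a y bead
      gapAt : ∀ {z} → pos a gap-pos ≡ z → inX a z ≡ false
      gapAt eq = subst (λ z → inX a z ≡ false) eq is-gap
      step : ∀ i → runner y ≡ i → cosetLength (gen i a) ℕ.+ 1 ≡ cosetLength a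
      step (Fin.suc j) ry = cosetLength-gen-suc-< j a (ℤP.<-≤-trans (inX-position-gap a (gapAt below)) (subst (λ r → Q ≤ a r) ry Q≤))
        where
        below : pos a gap-pos ≡ position (inject₁ j) Q
        below = trans gap≡ (trans (cong (_- + 1) (trans y≡ (cong (λ r → position r Q) ry)))
          (trans (unshift (+ toℕ j) (Q * + ℓ)) (cong (λ t → + t + Q * + ℓ) (sym (FinP.toℕ-inject₁ j)))))
          where unshift : ∀ t X → + 1 + t + X - + 1 ≡ t + X
                unshift = solve-∀
      step Fin.zero ry = cosetLength-gen-zero-≤ a (ℤP.≤-trans last+2≤Q (subst (λ r → Q ≤ a r) ry Q≤))
        where
        below : pos a gap-pos ≡ position last (Q - + 1)
        below = trans gap≡ (trans (cong (_- + 1) (trans y≡ (cong (λ r → position r Q) ry)))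
          (trans (wrap (+ m) Q) (cong (λ t → + t + (Q - + 1) * + ℓ) (sym (FinP.toℕ-fromℕ m)))))
          where wrap : ∀ M Q → + 0 + Q * (+ 1 + M) - + 1 ≡ M + (Q - + 1) * (+ 1 + M)
                wrap = solve-∀
        last+2≤Q : a last + + 2 ≤ Q
        last+2≤Q = subst₂ _≤_ (ℤP.+-assoc (a last) (+ 1) (+ 1)) (cancel Q) (ℤP.+-monoˡ-≤ (+ 1)
          (subst (_≤ Q - + 1) (ℤP.+-comm (+ 1) (a last)) (ℤP.i<j⇒suc[i]≤j (inX-position-gap a (gapAt below)))))
          where cancel : ∀ Q → Q - + 1 + + 1 ≡ Q
                cancel = solve-∀

  resSum-[] : resSum {ℓ} [] ≡ 0
  resSum-[] = trans (sum-upTo ℓ (longestWithRes {ℓ} [])) (≡0⇒sum≡0 (λ (j : Fin ℓ) → longestWithRes {ℓ} [] (toℕ j)) (λ _ → refl))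

  π≡[]⇒0 : ∀ a → InΛR a → π a ≡ [] → ∀ j → a j ≡ + 0
  π≡[]⇒0 a a∈Λ π≡[] = cosetLength≡0⇒0 a a∈Λ (trans (sym (resSum-π a a∈Λ)) (trans (cong (resSum {ℓ}) π≡[]) resSum-[]))

  ℓ≤hi : ∀ b → InΛR b → + ℓ ≤ hi b
  ℓ≤hi b b∈Λ = subst (_≤ hi b) (ℤP.*-identityʳ (+ ℓ)) (ℤP.*-monoˡ-≤-nonNeg (+ ℓ) (ℤP.+-monoˡ-≤ (+ 1) 0≤max))
    where
    nonneg : ∀ z → + 0 ≤ + ℓ * z → + 0 ≤ z
    nonneg (+ _)    _ = ℤ.+≤+ ℕ.z≤n
    nonneg -[1+ _ ] ()
    0≤max : + 0 ≤ maxV b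
    0≤max = nonneg (maxV b) (subst (_≤ + ℓ * maxV b) b∈Λ (sumℤ-≤ b (maxV b) (≤maxV b)))

  -- If the top bead of runner j in a has gaps below it, it ends a row of π a = π b, and the
  -- end of that row fixes the bead's position in b as well.  Otherwise all positions up to it
  -- are beads of a, and counting beads shows that the same position is a bead of b.
  module _ (a b : Vecℤ ℓ) (a∈Λ : InΛR a) (b∈Λ : InΛR b) (πa≡πb : π a ≡ π b) (j : Fin ℓ) where

    private
      k len k′ : ℕ
      k = topIndex a j
      len = length (rows a (size a))
      k′ = ∣ topBead a j - lo b ∣

      x : ℤ
      x = topBead a j

      rows≡ : rows a (size a) ≡ rows b (size b)
      rows≡ = trans (sym (π≡rows a)) (trans πa≡πb (π≡rows b))

      bead-at-x : ∀ {y} → inX b y ≡ true → y ≡ x → a j ≤ b j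
      bead-at-x by y≡x = inX-position-bead b (subst (λ z → inX b z ≡ true) y≡x by)

      x+len+1≤ℓ : gaps a k ≡ 0 → x + + len + + 1 ≤ + ℓ
      x+len+1≤ℓ gk≡0 = subst₂ _≤_ regroup (beads-size a a∈Λ)
        (ℤP.+-monoʳ-≤ (lo a) (ℤ.+≤+ (length-rows-zero-bead a (size a) (topIndex<size a j) (isBead-topIndex a j) gk≡0)))
        where
        shuffle : ∀ l L k → l + (L + (+ 1 + k)) ≡ l + k + L + + 1
        shuffle = solve-∀
        regroup : lo a + + (len ℕ.+ suc k) ≡ x + + len + + 1
        regroup = trans (shuffle (lo a) (+ len) (+ k)) (cong (λ z → z + + len + + 1) (pos-topIndex a j))

      pos-k′ : lo b ≤ x → pos b k′ ≡ x
      pos-k′ lo≤x = trans (cong (λ z → lo b + z) (ℤP.0≤i⇒+∣i∣≡i (ℤP.i≤j⇒0≤j-i lo≤x))) (cancel (lo b) x)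
        where cancel : ∀ u v → u + (v - u) ≡ v
              cancel = solve-∀

    topBead-ends-row : gaps a k ≢ 0 → a j ≤ b j
    topBead-ends-row gk≢0 with bead-row a (size a) 1 (topIndex<size a j) (isBead-topIndex a j) gk≢0
    ... | r , r∈ , index≡ = bead-at-x bead (∙-cancelʳ (- + ℓ) (pos b bead-at) x (begin
      pos b bead-at - + ℓ     ≡⟨ row-end b b∈Λ bead gaps≡ index≡′ ⟨
      + gaps a k - + r        ≡⟨ row-end a a∈Λ (isBead-topIndex a j) refl index≡ ⟩
      pos a k - + ℓ           ≡⟨ cong (_- + ℓ) (pos-topIndex a j) ⟩
      x - + ℓ                 ∎))
      where
      open ≡-Reasoning
      open RowSource b (rows-source b (size b) 1 (subst (λ L → (r , gaps a k) ∈ indexed 1 L) rows≡ r∈))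
        renaming (index≡ to index≡′)

    topBead-gapless : gaps a k ≡ 0 → lo b ≤ x → a j ≤ b j
    topBead-gapless gk≡0 lo≤x with isBead b k′ in bk′
    ... | true  = bead-at-x bk′ (pos-k′ lo≤x)
    ... | false = ⊥-elim (ℤP.<-irrefl refl (ℤP.≤-<-trans ℓ≤x+len (ℤP.<-≤-trans x+len<x+len+1 (x+len+1≤ℓ gk≡0))))
      where
      x+len<x+len+1 : x + + len < x + + len + + 1
      x+len<x+len+1 = subst (_< x + + len + + 1) (ℤP.+-identityʳ _) (ℤP.+-monoʳ-< (x + + len) (ℤ.+<+ (ℕ.s≤s ℕ.z≤n)))
      x<ℓ : x < + ℓ
      x<ℓ = ℤP.≤-<-trans (ℤP.i≤i+j x (+ len)) (ℤP.<-≤-trans x+len<x+len+1 (x+len+1≤ℓ gk≡0))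
      k′<size : k′ ℕ.< size b
      k′<size = ℤP.drop‿+<+ (subst₂ _<_ (sym (ℤP.0≤i⇒+∣i∣≡i (ℤP.i≤j⇒0≤j-i lo≤x))) (sym (+size b))
                  (ℤP.+-monoˡ-< (- lo b) (ℤP.<-≤-trans x<ℓ (ℓ≤hi b b∈Λ))))
      beads≤len+k′ : beads b (size b) ℕ.≤ len ℕ.+ k′
      beads≤len+k′ = subst (λ L → beads b (size b) ℕ.≤ length L ℕ.+ k′) (sym rows≡) (beads≤length-rows-gap b (size b) k′<size bk′)
      ℓ≤x+len : + ℓ ≤ x + + len
      ℓ≤x+len = subst₂ _≤_ (beads-size b b∈Λ) regroup (ℤP.+-monoʳ-≤ (lo b) (ℤ.+≤+ beads≤len+k′))
        where
        shuffle : ∀ l L K → l + (L + K) ≡ l + K + L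
        shuffle = solve-∀
        regroup : lo b + + (len ℕ.+ k′) ≡ x + + len
        regroup = trans (shuffle (lo b) (+ len) (+ k′)) (cong (_+ + len) (pos-k′ lo≤x))

    π-injective-≤ : a j ≤ b j
    π-injective-≤ with gaps a k ℕ.≟ 0 | lo b ℤ.≤? x
    ... | no gk≢0  | _        = topBead-ends-row gk≢0
    ... | yes gk≡0 | yes lo≤x = topBead-gapless gk≡0 lo≤x
    ... | yes _    | no lo≰x  = ℤP.≤-trans (level-mono-< j Fin.zero (subst (x <_) (lo≡position b) (ℤP.≰⇒> lo≰x))) (minV≤ b j)

  π-injective : ∀ a b → InΛR a → InΛR b → π a ≡ π b → ∀ j → a j ≡ b j
  π-injective a b a∈Λ b∈Λ πa≡πb j = ℤP.≤-antisym (π-injective-≤ a b a∈Λ b∈Λ πa≡πb j) (π-injective-≤ b a b∈Λ a∈Λ (sym πa≡πb) j)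

module CosetWords (n : ℕ) where

  open import Data.Nat using (_≤_)

  open Generators n
  open LengthFunction n
  open Abacus n using (π≡[]⇒0; π-injective; resSum-π; descent)

  lastRes<ℓ : ∀ λ′ → lastRes {ℓ} λ′ ℕ.< ℓ
  lastRes<ℓ λ′ = foldr-const-< (rowRes {ℓ}) (λ (r , p) → n%ℕd<d (+ p ℤ.- + r) ℓ) (ℕ.s≤s ℕ.z≤n) (reverse (indexedRows {ℓ} λ′))

  cosetLength-act-0 : ∀ u (x : Vecℤ ℓ) → (∀ k → x k ≡ + 0) → cosetLength (act u x) ≤ length u
  cosetLength-act-0 []      x x≡0 = ℕP.≤-reflexive (cosetLength-0 x x≡0)
  cosetLength-act-0 (i ∷ u) x x≡0 = ℕP.≤-trans (cosetLength-gen-≤ i (act u x))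
    (ℕP.≤-trans (ℕP.+-monoˡ-≤ 1 (cosetLength-act-0 u x x≡0)) (ℕP.≤-reflexive (ℕP.+-comm (length u) 1)))

  cosetLength≤length : ∀ a u → InCoset a u → cosetLength a ≤ length u
  cosetLength≤length a u (σ , σ-finite , u≡σ+a) = ℕP.≤-trans (ℕP.≤-reflexive (cosetLength-cong u0≡a)) (cosetLength-act-0 u 0̄ (λ _ → refl))
    where
    0̄ : Vecℤ ℓ
    0̄ _ = + 0
    0̄∈Λ : ∀ {N} → sumℤ {N} (λ _ → + 0) ≡ + 0
    0̄∈Λ {zero}  = refl
    0̄∈Λ {suc N} = trans (ℤP.+-identityˡ _) (0̄∈Λ {N})
    u0≡a : ∀ k → a k ≡ act u 0̄ k
    u0≡a k = sym (trans (u≡σ+a 0̄ (0̄∈Λ {ℓ}) k) (trans (cong (ℤ._+ a k) (finiteWord-fixes-0 σ σ-finite 0̄ (λ _ → refl) k)) (ℤP.+-identityˡ (a k))))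

  wordOf-length-coset : ∀ {λ′ w} → WordOf λ′ w → ∀ b → InΛR b → π b ≡ λ′ → (length w ≡ cosetLength b) × InCoset b w
  wordOf-length-coset wEmpty b b∈Λ π≡[] =
    sym (cosetLength-0 b b≡0) , InCoset-[] b b≡0
    where b≡0 : ∀ k → b k ≡ + 0
          b≡0 = π≡[]⇒0 b b∈Λ π≡[]
  wordOf-length-coset (wStep {w = w} i a a∈Λ πa≡λ λ≢[] i≡res rest) b b∈Λ πb≡λ = length≡ , InCoset-cong {a = b} {b = a} {w = i ∷ w} b≗a (InCoset-∷ i a w (proj₂ ih))
    where
    b≗a : ∀ k → b k ≡ a k
    b≗a = π-injective b a b∈Λ a∈Λ (trans πb≡λ (sym πa≡λ))
    ih : (length w ≡ cosetLength (gen i a)) × InCoset (gen i a) w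
    ih = wordOf-length-coset rest (gen i a) (InΛR-gen i a a∈Λ) refl
    length≡ : suc (length w) ≡ cosetLength b
    length≡ = begin
      suc (length w)                   ≡⟨ cong suc (proj₁ ih) ⟩
      suc (cosetLength (gen i a))      ≡⟨ ℕP.+-comm 1 (cosetLength (gen i a)) ⟩
      cosetLength (gen i a) ℕ.+ 1      ≡⟨ descent a a∈Λ i (λ≢[] ∘ trans (sym πa≡λ)) (trans i≡res (cong (lastRes {ℓ}) (sym πa≡λ))) ⟩
      cosetLength a                    ≡⟨ cosetLength-cong b≗a ⟨
      cosetLength b                    ∎
      where open ≡-Reasoning

  wordOf-exists : ∀ N a → InΛR a → cosetLength a ≤ N → Σ (Word ℓ) (WordOf (π a))
  wordOf-exists N a a∈Λ len≤N = cases (π a) refl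
    where
    cases : ∀ λ′ → π a ≡ λ′ → Σ (Word ℓ) (WordOf (π a))
    cases []      π≡[] = [] , subst (λ λ′ → WordOf λ′ []) (sym π≡[]) wEmpty
    cases (_ ∷ _) π≡∷  = step N len≤N
      where
      π≢[] : π a ≢ []
      π≢[] π≡[] = ∷≢[] (trans (sym π≡∷) π≡[])
      i : Fin ℓ
      i = fromℕ< (lastRes<ℓ (π a))
      i≡res : toℕ i ≡ lastRes {ℓ} (π a)
      i≡res = FinP.toℕ-fromℕ< (lastRes<ℓ (π a))
      desc : cosetLength (gen i a) ℕ.+ 1 ≡ cosetLength a
      desc = descent a a∈Λ i π≢[] i≡res
      step : ∀ N → cosetLength a ≤ N → Σ (Word ℓ) (WordOf (π a))
      step zero    len≤0 = ⊥-elim (ℕP.1+n≢0 (trans (ℕP.+-comm 1 (cosetLength (gen i a))) (trans desc (ℕP.n≤0⇒n≡0 len≤0))))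
      step (suc N) len≤1+N = i ∷ proj₁ rest , wStep i a a∈Λ refl π≢[] i≡res (proj₂ rest)
        where
        rest : Σ (Word ℓ) (WordOf (π (gen i a)))
        rest = wordOf-exists N (gen i a) (InΛR-gen i a a∈Λ)
          (ℕP.≤-pred (ℕP.≤-trans (ℕP.≤-reflexive (trans (ℕP.+-comm 1 (cosetLength (gen i a))) desc)) len≤1+N))

  InCoset-SameElt : ∀ {a : Vecℤ ℓ} v w → SameElt v w → InCoset a w → InCoset a v
  InCoset-SameElt v w v~w (σ , σ-finite , w≡σ+a) = σ , σ-finite , λ x x∈Λ k → trans (v~w x x∈Λ k) (w≡σ+a x x∈Λ k)

  wordOf-minimal : ∀ a → InΛR a → ∀ w → WordOf (π a) w →
                   IsReduced w × InCoset a w × (∀ u → InCoset a u → length w ≤ length u) × CoxLen w (resSum {ℓ} (π a))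
  wordOf-minimal a a∈Λ w w-word =
      (λ v v~w → minimal v (InCoset-SameElt v w v~w w∈coset))
    , w∈coset
    , minimal
    , (w , (λ _ _ _ → refl) , trans length≡ (sym (resSum-π a a∈Λ)))
    , (λ v v~w → ℕP.≤-trans (ℕP.≤-reflexive (resSum-π a a∈Λ)) (cosetLength≤length a v (InCoset-SameElt v w v~w w∈coset)))
    where
    length≡ : length w ≡ cosetLength a
    length≡ = proj₁ (wordOf-length-coset w-word a a∈Λ refl)
    w∈coset : InCoset a w
    w∈coset = proj₂ (wordOf-length-coset w-word a a∈Λ refl)
    minimal : ∀ u → InCoset a u → length w ≤ length u
    minimal u u∈coset = ℕP.≤-trans (ℕP.≤-reflexive length≡) (cosetLength≤length a u u∈coset)

open import Data.Nat using (NonZero; _≤_)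
open import Data.List using (length)
open import Data.Product using (Σ; _×_)

proposition3p9 : ∀ (ℓ : ℕ) .{{_ : NonZero ℓ}} → 2 ≤ ℓ →
    ∀ (a : Vecℤ ℓ) → InΛR a →
    (Σ (Word ℓ) λ w → WordOf (π a) w) ×
    (∀ (w : Word ℓ) → WordOf (π a) w →
      IsReduced w ×
      InCoset a w ×
      (∀ (u : Word ℓ) → InCoset a u → length w ≤ length u) ×
      CoxLen w (resSum (π a)))
proposition3p9 (suc (suc n)) (ℕ.s≤s (ℕ.s≤s ℕ.z≤n)) a a∈Λ =
  wordOf-exists (cosetLength a) a a∈Λ ℕP.≤-refl , wordOf-minimal a a∈Λ
  where
  open CosetWords n
  open LengthFunction n using (cosetLength)
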